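{- For any integer $N$ and $d\in\{3,6\}$ there exists a simple $1$-planar graph $S_d$ with $n\geq N$ vertices such that: for $d=3$, $S_3$ has a $3$-independent set of size $\frac{6}{7}(n-2)$; for $d=6$, $S_6$ has a $6$-independent set of size $\frac{1}{2}(n-3)$.
   Context: A $d$-independent set of $G$ is an independent set $I$ such that every vertex of $I$ has degree at least $d$ in $G$. A graph is $1$-planar if it can be drawn in the plane so that every edge is crossed at most once. -}

module Defs where

open import Data.Nat as ℕ using (ℕ; _≤_)
open import Data.Bool using (Bool; true; false; if_then_else_)
open import Data.Fin using (Fin)
open import Data.Fin.Subset using (Subset; _∈_; ∣_∣)
open import Data.List using (List; []; _∷_; _++_; [_]; reverse; map; allFin)
open import Data.Nat.ListAction using (sum)
open import Data.Empty using (⊥)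
open import Data.Product using (Σ; ∃; _×_; _,_)
open import Data.Sum using (_⊎_)
open import Data.Rational as ℚ using (ℚ; 0ℚ; 1ℚ)
open import Relation.Binary.PropositionalEquality using (_≡_)
open import Relation.Nullary using (¬_)

record SimpleGraph (n : ℕ) : Set where
  field
    Adj   : Fin n → Fin n → Bool
    sym   : ∀ u v → Adj u v ≡ Adj v u
    irrefl : ∀ v → Adj v v ≡ false
open SimpleGraph public

degree : ∀ {n} → SimpleGraph n → Fin n → ℕ
degree {n} G u = sum (map (λ v → if Adj G u v then 1 else 0) (allFin n))

Independent : ∀ {n} → SimpleGraph n → Subset n → Set
Independent G I = ∀ u v → u ∈ I → v ∈ I → Adj G u v ≡ false

IsDIndependent : ∀ {n} → ℕ → SimpleGraph n → Subset n → Set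
IsDIndependent d G I = Independent G I × (∀ v → v ∈ I → d ≤ degree G v)

Point : Set
Point = ℚ × ℚ

OnSeg : Point → Point → Point → Set
OnSeg (px , py) (ax , ay) (bx , by) =
  Σ ℚ λ t → (0ℚ ℚ.≤ t) × (t ℚ.≤ 1ℚ)
          × (px ≡ ax ℚ.+ t ℚ.* (bx ℚ.- ax))
          × (py ≡ ay ℚ.+ t ℚ.* (by ℚ.- ay))

OnPath : Point → List Point → Set
OnPath p []            = ⊥
OnPath p (a ∷ [])      = ⊥
OnPath p (a ∷ b ∷ ps)  = OnSeg p a b ⊎ OnPath p (b ∷ ps)

SamePair : ∀ {n} → Fin n → Fin n → Fin n → Fin n → Set
SamePair u v x y = (u ≡ x × v ≡ y) ⊎ (u ≡ y × v ≡ x)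

-- A 1-planar drawing of G: vertices are distinct points; each edge uv is
-- the polygonal arc pos u, bends u v, pos v (the reverse arc for vu);
-- no edge passes through a vertex other than its endpoints; and every edge
-- meets the other edges (away from vertices) in at most one point, lying
-- on only one other edge, i.e. each edge is crossed at most once.
record OnePlanarDrawing {n : ℕ} (G : SimpleGraph n) : Set where
  field
    pos    : Fin n → Point
    bends  : Fin n → Fin n → List Point
  curve : Fin n → Fin n → List Point
  curve u v = pos u ∷ (bends u v ++ [ pos v ])
  Interior : Point → Fin n → Fin n → Set
  Interior p u v = OnPath p (curve u v) × (∀ w → ¬ (p ≡ pos w))
  field
    pos-inj     : ∀ u v → pos u ≡ pos v → u ≡ v
    bends-sym   : ∀ u v → bends v u ≡ reverse (bends u v)
    avoid-verts : ∀ u v w → Adj G u v ≡ true → OnPath (pos w) (curve u v)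
                  → (w ≡ u) ⊎ (w ≡ v)
    one-crossing :
      ∀ u v x y x′ y′ p q →
      Adj G u v ≡ true → Adj G x y ≡ true → Adj G x′ y′ ≡ true →
      ¬ SamePair u v x y → ¬ SamePair u v x′ y′ →
      Interior p u v → OnPath p (curve x y) →
      Interior q u v → OnPath q (curve x′ y′) →
      (p ≡ q) × SamePair x y x′ y′

OnePlanar : ∀ {n} → SimpleGraph n → Set
OnePlanar G = OnePlanarDrawing G

{-# OPTIONS --safe #-}
-- Both graphs are towers of nested drawings inside the triangle T with corners (0,1024), (-1024,-512),
-- (1024,-512). A framed drawing has its first three vertices at the corners of T. A collar is a drawing
-- in T with three vertices at the corners of T/4 (T scaled by 1/4) whose other vertices and edges meet
-- T/4 at most in these corners. Shrinking a framed drawing into T/4 and gluing it into a collar keeps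
-- the drawing 1-planar, since no edge of the collar enters T/4; if the collar also has vertices at the
-- corners of T, the result is framed again. Marked independent sets avoiding the glued corners add up,
-- and degrees only grow. For d = 6 each layer adds 6 vertices, 3 of them marked of degree 6, starting
-- from the bare triangle, so 2|I| = n - 3. For d = 3 each layer adds 21 vertices, 18 of them marked of
-- degree 3, starting from T with three marked vertices inside, and a final collar adds three marked
-- vertices, so 7|I| = 6(n - 2).
module Submission where

module Literals where

  open import Agda.Builtin.FromNat using (Number)
  open import Agda.Builtin.FromNeg using (Negative)
  open import Data.Nat using (ℕ)
  open import Data.Rational using (ℚ)
  import Data.Nat.Literals as ℕ
  import Data.Rational.Literals as ℚ

  instance
    ℕ-number : Number ℕ
    ℕ-number = ℕ.number

    ℚ-number : Number ℚ
    ℚ-number = ℚ.number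

    ℚ-negative : Negative ℚ
    ℚ-negative = ℚ.negative

module Segments where

  open import Defs using (Point; OnSeg)
  open import Data.Rational as ℚ using (ℚ; _+_; _*_; _-_; -_; 0ℚ; 1ℚ; _≤_; _<_; 1/_; NonZero)
  import Data.Rational.Properties as ℚₚ
  open import Data.Rational.Solver using (module +-*-Solver)
  open +-*-Solver using (solve; _:+_; _:*_; _:-_; _:=_; con)
  open import Data.Product using (_,_; proj₁; proj₂)
  open import Data.Sum using (_⊎_; inj₁; inj₂)
  open import Relation.Binary.PropositionalEquality

  X Y : Point → ℚ
  X = proj₁
  Y = proj₂

  lerp : ℚ → ℚ → ℚ → ℚ
  lerp u v t = u + t * (v - u)

  lerp-0 : ∀ u v → lerp u v 0ℚ ≡ u
  lerp-0 = solve 2 (λ u v → u :+ con 0ℚ :* (v :- u) := u) refl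

  lerp-1 : ∀ u v → lerp u v 1ℚ ≡ v
  lerp-1 = solve 2 (λ u v → u :+ con 1ℚ :* (v :- u) := v) refl

  private
    0≤v-u : ∀ {u v} → u ≤ v → 0ℚ ≤ v - u
    0≤v-u {u} {v} u≤v = subst (_≤ v - u) (ℚₚ.+-inverseʳ u) (ℚₚ.+-monoˡ-≤ (- u) u≤v)

    v-u≤0 : ∀ {u v} → v ≤ u → v - u ≤ 0ℚ
    v-u≤0 {u} {v} v≤u = subst (v - u ≤_) (ℚₚ.+-inverseʳ u) (ℚₚ.+-monoˡ-≤ (- u) v≤u)

  module _ (u v : ℚ) {t : ℚ} (0≤t : 0ℚ ≤ t) (t≤1 : t ≤ 1ℚ) where

    lerp-≤-end : lerp u v t ≤ u ⊎ lerp u v t ≤ v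
    lerp-≤-end with ℚₚ.≤-total u v
    ... | inj₁ u≤v = inj₂ (subst (lerp u v t ≤_) (lerp-1 u v)
            (ℚₚ.+-monoʳ-≤ u (ℚₚ.*-monoʳ-≤-nonNeg (v - u) {{ℚ.nonNegative (0≤v-u u≤v)}} t≤1)))
    ... | inj₂ v≤u = inj₁ (subst (lerp u v t ≤_) (lerp-0 u v)
            (ℚₚ.+-monoʳ-≤ u (ℚₚ.*-monoʳ-≤-nonPos (v - u) {{ℚ.nonPositive (v-u≤0 v≤u)}} 0≤t)))

    end-≤-lerp : u ≤ lerp u v t ⊎ v ≤ lerp u v t
    end-≤-lerp with ℚₚ.≤-total u v
    ... | inj₁ u≤v = inj₁ (subst (_≤ lerp u v t) (lerp-0 u v)
            (ℚₚ.+-monoʳ-≤ u (ℚₚ.*-monoʳ-≤-nonNeg (v - u) {{ℚ.nonNegative (0≤v-u u≤v)}} 0≤t)))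
    ... | inj₂ v≤u = inj₂ (subst (_≤ lerp u v t) (lerp-1 u v)
            (ℚₚ.+-monoʳ-≤ u (ℚₚ.*-monoʳ-≤-nonPos (v - u) {{ℚ.nonPositive (v-u≤0 v≤u)}} t≤1)))

  *-cancelʳ-≡ : ∀ {t s d} → d ≢ 0ℚ → t * d ≡ s * d → t ≡ s
  *-cancelʳ-≡ {t} {s} {d} d≢0 td≡sd = begin
    t                   ≡⟨ divide t ⟨
    (t * d) * (1/ d)    ≡⟨ cong (_* (1/ d)) td≡sd ⟩
    (s * d) * (1/ d)    ≡⟨ divide s ⟩
    s                   ∎
    where
    open ≡-Reasoning
    instance
      _ : NonZero d
      _ = ℚ.≢-nonZero d≢0
    divide : ∀ r → (r * d) * (1/ d) ≡ r
    divide r = begin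
      (r * d) * (1/ d)  ≡⟨ ℚₚ.*-assoc r d (1/ d) ⟩
      r * (d * (1/ d))  ≡⟨ cong (r *_) (ℚₚ.*-inverseʳ d) ⟩
      r * 1ℚ            ≡⟨ ℚₚ.*-identityʳ r ⟩
      r                 ∎

  lerp-injective : ∀ u v {t s} → v ≢ u → lerp u v t ≡ lerp u v s → t ≡ s
  lerp-injective u v {t} {s} v≢u eq = *-cancelʳ-≡ v-u≢0 (begin
    t * (v - u)           ≡⟨ shift t ⟨
    lerp u v t - u        ≡⟨ cong (_- u) eq ⟩
    lerp u v s - u        ≡⟨ shift s ⟩
    s * (v - u)           ∎)
    where
    open ≡-Reasoning
    shift : ∀ t → lerp u v t - u ≡ t * (v - u)
    shift = solve 3 (λ u v t → (u :+ t :* (v :- u)) :- u := t :* (v :- u)) refl u v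
    v-u≢0 : v - u ≢ 0ℚ
    v-u≢0 eq = v≢u (begin
      v             ≡⟨ solve 2 (λ v u → v := (v :- u) :+ u) refl v u ⟩
      (v - u) + u   ≡⟨ cong (_+ u) eq ⟩
      0ℚ + u        ≡⟨ ℚₚ.+-identityˡ u ⟩
      u             ∎)

  onSeg-reverse : ∀ p a b → OnSeg p a b → OnSeg p b a
  onSeg-reverse _ a b (t , 0≤t , t≤1 , px , py) =
    1ℚ - t , 0≤v-u t≤1 , 1-t≤1 , trans px (flip (X a) (X b) t) , trans py (flip (Y a) (Y b) t)
    where
    flip : ∀ u v t → lerp u v t ≡ lerp v u (1ℚ - t)
    flip = solve 3 (λ u v t → u :+ t :* (v :- u) := v :+ (con 1ℚ :- t) :* (u :- v)) refl
    1-t≤1 : 1ℚ - t ≤ 1ℚ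
    1-t≤1 = ℚₚ.+-monoʳ-≤ 1ℚ (ℚₚ.neg-antimono-≤ 0≤t)

  onSeg-start : ∀ a b → OnSeg a a b
  onSeg-start a b = 0ℚ , ℚₚ.≤-refl , ℚₚ.≤ᵇ⇒≤ _ , sym (lerp-0 (X a) (X b)) , sym (lerp-0 (Y a) (Y b))

  Affine : (Point → ℚ) → Set
  Affine f = ∀ p a b (o : OnSeg p a b) → f p ≡ lerp (f a) (f b) (proj₁ o)

  X-affine : Affine X
  X-affine _ _ _ (_ , _ , _ , px , _) = px

  Y-affine : Affine Y
  Y-affine _ _ _ (_ , _ , _ , _ , py) = py

  linear : ℚ → ℚ → Point → ℚ
  linear α β p = α * X p + β * Y p

  linear-affine : ∀ α β → Affine (linear α β)
  linear-affine α β _ a b (t , _ , _ , refl , refl) =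
    solve 7 (λ α β ax ay bx by t →
        α :* (ax :+ t :* (bx :- ax)) :+ β :* (ay :+ t :* (by :- ay))
      := (α :* ax :+ β :* ay) :+ t :* ((α :* bx :+ β :* by) :- (α :* ax :+ β :* ay)))
      refl α β (X a) (Y a) (X b) (Y b) t

  side : Point → Point → Point → ℚ
  side a b p = (X b - X a) * (Y p - Y a) - (Y b - Y a) * (X p - X a)

  side-affine : ∀ a b → Affine (side a b)
  side-affine a b _ c d (t , _ , _ , refl , refl) =
    solve 9 (λ ax ay bx by cx cy dx dy t →
        (bx :- ax) :* ((cy :+ t :* (dy :- cy)) :- ay) :- (by :- ay) :* ((cx :+ t :* (dx :- cx)) :- ax)
      := ((bx :- ax) :* (cy :- ay) :- (by :- ay) :* (cx :- ax))
         :+ t :* (((bx :- ax) :* (dy :- ay) :- (by :- ay) :* (dx :- ax))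
                  :- ((bx :- ax) :* (cy :- ay) :- (by :- ay) :* (cx :- ax))))
      refl (X a) (Y a) (X b) (Y b) (X c) (Y c) (X d) (Y d) t

  side-onSeg : ∀ p a b → OnSeg p a b → side a b p ≡ 0ℚ
  side-onSeg _ a b (t , _ , _ , refl , refl) =
    solve 5 (λ ax ay bx by t →
        (bx :- ax) :* ((ay :+ t :* (by :- ay)) :- ay) :- (by :- ay) :* ((ax :+ t :* (bx :- ax)) :- ax)
      := con 0ℚ)
      refl (X a) (Y a) (X b) (Y b) t

  module _ {f : Point → ℚ} (f-affine : Affine f) (p a b : Point) (o : OnSeg p a b) where

    private
      0≤t : 0ℚ ≤ proj₁ o
      0≤t = proj₁ (proj₂ o)
      t≤1 : proj₁ o ≤ 1ℚ
      t≤1 = proj₁ (proj₂ (proj₂ o))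
      f-at-p : f p ≡ lerp (f a) (f b) (proj₁ o)
      f-at-p = f-affine p a b o

    affine-< : ∀ {k} → f a < k → f b < k → f p < k
    affine-< fa<k fb<k with lerp-≤-end (f a) (f b) 0≤t t≤1
    ... | inj₁ ≤fa = ℚₚ.≤-<-trans (ℚₚ.≤-reflexive f-at-p) (ℚₚ.≤-<-trans ≤fa fa<k)
    ... | inj₂ ≤fb = ℚₚ.≤-<-trans (ℚₚ.≤-reflexive f-at-p) (ℚₚ.≤-<-trans ≤fb fb<k)

    affine-≤ : ∀ {k} → f a ≤ k → f b ≤ k → f p ≤ k
    affine-≤ fa≤k fb≤k with lerp-≤-end (f a) (f b) 0≤t t≤1
    ... | inj₁ ≤fa = ℚₚ.≤-trans (ℚₚ.≤-reflexive f-at-p) (ℚₚ.≤-trans ≤fa fa≤k)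
    ... | inj₂ ≤fb = ℚₚ.≤-trans (ℚₚ.≤-reflexive f-at-p) (ℚₚ.≤-trans ≤fb fb≤k)

    affine-> : ∀ {k} → k < f a → k < f b → k < f p
    affine-> k<fa k<fb with end-≤-lerp (f a) (f b) 0≤t t≤1
    ... | inj₁ fa≤ = ℚₚ.<-≤-trans (ℚₚ.<-≤-trans k<fa fa≤) (ℚₚ.≤-reflexive (sym f-at-p))
    ... | inj₂ fb≤ = ℚₚ.<-≤-trans (ℚₚ.<-≤-trans k<fb fb≤) (ℚₚ.≤-reflexive (sym f-at-p))

    affine-≥ : ∀ {k} → k ≤ f a → k ≤ f b → k ≤ f p
    affine-≥ k≤fa k≤fb with end-≤-lerp (f a) (f b) 0≤t t≤1
    ... | inj₁ fa≤ = ℚₚ.≤-trans (ℚₚ.≤-trans k≤fa fa≤) (ℚₚ.≤-reflexive (sym f-at-p))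
    ... | inj₂ fb≤ = ℚₚ.≤-trans (ℚₚ.≤-trans k≤fb fb≤) (ℚₚ.≤-reflexive (sym f-at-p))

  affine-injective : ∀ {f} → Affine f → ∀ p q a b → f b ≢ f a →
                     (o : OnSeg p a b) (o′ : OnSeg q a b) → f p ≡ f q → p ≡ q
  affine-injective {f} f-affine p q a b fb≢fa o o′ fp≡fq =
    cong₂ _,_ (same-lerp X (X-affine p a b o) (X-affine q a b o′))
              (same-lerp Y (Y-affine p a b o) (Y-affine q a b o′))
    where
    t≡s : proj₁ o ≡ proj₁ o′
    t≡s = lerp-injective (f a) (f b) fb≢fa
            (trans (sym (f-affine p a b o)) (trans fp≡fq (f-affine q a b o′)))
    same-lerp : ∀ (g : Point → ℚ) → g p ≡ lerp (g a) (g b) (proj₁ o) → g q ≡ lerp (g a) (g b) (proj₁ o′) →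
                g p ≡ g q
    same-lerp g gp gq = trans gp (trans (cong (lerp (g a) (g b)) t≡s) (sym gq))

module Polylines where

  open import Defs using (Point; OnSeg; OnPath)
  open Segments using (onSeg-reverse)
  open import Data.List using (List; []; _∷_; _++_; [_]; reverse)
  open import Data.List.Properties using (unfold-reverse; ++-assoc; reverse-involutive)
  open import Data.List.Membership.Propositional using (_∈_)
  open import Data.List.Relation.Unary.Any using (here; there)
  open import Data.Product using (∃; _×_; _,_; proj₁; proj₂)
  open import Data.Sum using (inj₁; inj₂)
  open import Relation.Binary.PropositionalEquality hiding ([_])

  segments : List Point → List (Point × Point)
  segments (a ∷ b ∷ l) = (a , b) ∷ segments (b ∷ l)
  segments _           = []

  onPath⇒onSegment : ∀ {p} l → OnPath p l → ∃ λ s → s ∈ segments l × OnSeg p (proj₁ s) (proj₂ s)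
  onPath⇒onSegment (a ∷ b ∷ l) (inj₁ s) = (a , b) , here refl , s
  onPath⇒onSegment (a ∷ b ∷ l) (inj₂ o) with onPath⇒onSegment (b ∷ l) o
  ... | s , s∈ , os = s , there s∈ , os

  segment-ends : ∀ {a b} l → (a , b) ∈ segments l → a ∈ l × b ∈ l
  segment-ends (a ∷ b ∷ l) (here refl) = here refl , there (here refl)
  segment-ends (c ∷ b ∷ l) (there s∈) with segment-ends (b ∷ l) s∈
  ... | a∈ , b∈ = there a∈ , there b∈

  onPath-++ˡ : ∀ {p} xs ys → OnPath p xs → OnPath p (xs ++ ys)
  onPath-++ˡ (a ∷ b ∷ xs) ys (inj₁ s) = inj₁ s
  onPath-++ˡ (a ∷ b ∷ xs) ys (inj₂ o) = inj₂ (onPath-++ˡ (b ∷ xs) ys o)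

  onPath-last : ∀ {p} xs a b → OnSeg p a b → OnPath p (xs ++ a ∷ b ∷ [])
  onPath-last []           a b s = inj₁ s
  onPath-last (x ∷ [])     a b s = inj₂ (inj₁ s)
  onPath-last (x ∷ y ∷ xs) a b s = inj₂ (onPath-last (y ∷ xs) a b s)

  onPath-reverse : ∀ {p} l → OnPath p l → OnPath p (reverse l)
  onPath-reverse {p} (a ∷ b ∷ l) (inj₁ s) =
    subst (OnPath p) reverse-a∷b∷l (onPath-last (reverse l) b a (onSeg-reverse p a b s))
    where
    open ≡-Reasoning
    reverse-a∷b∷l : reverse l ++ b ∷ a ∷ [] ≡ reverse (a ∷ b ∷ l)
    reverse-a∷b∷l = begin
      reverse l ++ [ b ] ++ [ a ]    ≡⟨ ++-assoc (reverse l) [ b ] [ a ] ⟨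
      (reverse l ++ [ b ]) ++ [ a ]  ≡⟨ cong (_++ [ a ]) (unfold-reverse b l) ⟨
      reverse (b ∷ l) ++ [ a ]       ≡⟨ unfold-reverse a (b ∷ l) ⟨
      reverse (a ∷ b ∷ l)            ∎
  onPath-reverse {p} (a ∷ b ∷ l) (inj₂ o) =
    subst (OnPath p) (sym (unfold-reverse a (b ∷ l))) (onPath-++ˡ _ [ a ] (onPath-reverse (b ∷ l) o))

  onPath-reverse⁻ : ∀ {p} l → OnPath p (reverse l) → OnPath p l
  onPath-reverse⁻ {p} l o = subst (OnPath p) (reverse-involutive l) (onPath-reverse (reverse l) o)

module Scaling where

  open import Defs using (Point; OnSeg; OnPath)
  open Segments
  open import Data.Rational as ℚ using (ℚ; _+_; _*_)
  open import Data.Rational.Solver using (module +-*-Solver)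
  open +-*-Solver using (solve; _:+_; _:*_; _:-_; _:=_; con)
  open import Data.Integer using (+_)
  open import Data.List using ([]; _∷_; map)
  open import Data.Product using (_,_)
  open import Data.Sum using (inj₁; inj₂)
  open import Relation.Binary.PropositionalEquality

  scale : ℚ → Point → Point
  scale k p = k * X p , k * Y p

  scale-linear : ∀ k α β p → linear α β (scale k p) ≡ k * linear α β p
  scale-linear k α β p =
    solve 5 (λ k α β x y → α :* (k :* x) :+ β :* (k :* y) := k :* (α :* x :+ β :* y)) refl k α β (X p) (Y p)

  scale-onSeg : ∀ k p a b → OnSeg p a b → OnSeg (scale k p) (scale k a) (scale k b)
  scale-onSeg k _ a b (t , 0≤t , t≤1 , refl , refl) =
    t , 0≤t , t≤1 , scale-lerp (X a) (X b) , scale-lerp (Y a) (Y b)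
    where
    scale-lerp : ∀ u v → k * lerp u v t ≡ lerp (k * u) (k * v) t
    scale-lerp u v = solve 4 (λ k u v t → k :* (u :+ t :* (v :- u)) := k :* u :+ t :* (k :* v :- k :* u)) refl k u v t

  scale-onPath : ∀ k {p} l → OnPath p l → OnPath (scale k p) (map (scale k) l)
  scale-onPath k {p} (a ∷ b ∷ l) (inj₁ s) = inj₁ (scale-onSeg k p a b s)
  scale-onPath k     (a ∷ b ∷ l) (inj₂ o) = inj₂ (scale-onPath k (b ∷ l) o)

  opaque
    ¼ 4ℚ : ℚ
    ¼ = + 1 ℚ./ 4
    4ℚ = + 4 ℚ./ 1

  shrink grow : Point → Point
  shrink = scale ¼
  grow = scale 4ℚ

  opaque
    unfolding ¼ 4ℚ

    grow-shrink : ∀ p → grow (shrink p) ≡ p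
    grow-shrink p = cong₂ _,_ (cancel (X p)) (cancel (Y p))
      where
      cancel : ∀ x → 4ℚ * (¼ * x) ≡ x
      cancel = solve 1 (λ x → con 4ℚ :* (con ¼ :* x) := x) refl

    shrink-grow : ∀ p → shrink (grow p) ≡ p
    shrink-grow p = cong₂ _,_ (cancel (X p)) (cancel (Y p))
      where
      cancel : ∀ x → ¼ * (4ℚ * x) ≡ x
      cancel = solve 1 (λ x → con ¼ :* (con 4ℚ :* x) := x) refl

  shrink-injective : ∀ {p q} → shrink p ≡ shrink q → p ≡ q
  shrink-injective {p} {q} eq = trans (sym (grow-shrink p)) (trans (cong grow eq) (grow-shrink q))

  grow-injective : ∀ {p q} → grow p ≡ grow q → p ≡ q
  grow-injective {p} {q} eq = trans (sym (shrink-grow p)) (trans (cong shrink eq) (shrink-grow q))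

  grow-onPath : ∀ {p} l → OnPath p (map shrink l) → OnPath (grow p) l
  grow-onPath {p} l o = subst (OnPath (grow p)) (grow-shrink-list l) (scale-onPath 4ℚ (map shrink l) o)
    where
    grow-shrink-list : ∀ l → map grow (map shrink l) ≡ l
    grow-shrink-list []      = refl
    grow-shrink-list (a ∷ l) = cong₂ _∷_ (grow-shrink a) (grow-shrink-list l)

module Triangles where

  open import Defs using (Point; OnSeg)
  open Segments using (Affine; linear; linear-affine; affine-≤)
  open Scaling using (¼; shrink; scale-linear)
  open Literals
  open import Agda.Builtin.FromNat using (fromNat)
  open import Agda.Builtin.FromNeg using (fromNeg)
  open import Data.Unit using (tt)
  open import Data.Rational using (ℚ; _*_; _≤_)
  import Data.Rational.Properties as ℚₚ
  open import Data.Fin using (Fin; zero; suc)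
  open import Data.Fin.Properties using (all?)
  open import Relation.Nullary using (Dec)
  open import Data.Product using (_,_)
  open import Relation.Binary.PropositionalEquality

  -- InTriangle 2048 is the triangle T with corners (0,1024), (-1024,-512), (1024,-512),
  -- and InTriangle 512 is its image T/4 under shrink.
  edgeForm : Fin 3 → Point → ℚ
  edgeForm zero             = linear 0 -4
  edgeForm (suc zero)       = linear -3 2
  edgeForm (suc (suc zero)) = linear 3 2

  InTriangle : ℚ → Point → Set
  InTriangle c z = ∀ i → edgeForm i z ≤ c

  inTriangle? : ∀ c z → Dec (InTriangle c z)
  inTriangle? c z = all? (λ i → edgeForm i z ℚₚ.≤? c)

  edgeForm-affine : ∀ i → Affine (edgeForm i)
  edgeForm-affine zero             = linear-affine 0 -4
  edgeForm-affine (suc zero)       = linear-affine -3 2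
  edgeForm-affine (suc (suc zero)) = linear-affine 3 2

  inTriangle-onSeg : ∀ {c} p a b → OnSeg p a b → InTriangle c a → InTriangle c b → InTriangle c p
  inTriangle-onSeg p a b o a∈ b∈ i = affine-≤ (edgeForm-affine i) p a b o (a∈ i) (b∈ i)

  opaque
    outer inner : ℚ
    outer = 2048
    inner = 512

    outer-def : outer ≡ 2048
    outer-def = refl

    inner-def : inner ≡ 512
    inner-def = refl

  Outer Inner : Point → Set
  Outer = InTriangle outer
  Inner = InTriangle inner

  Outer-literal : Outer ≡ InTriangle 2048
  Outer-literal = cong InTriangle outer-def

  Inner-literal : Inner ≡ InTriangle 512
  Inner-literal = cong InTriangle inner-def

  opaque
    unfolding ¼ outer

    shrink-inside : ∀ {p} → Outer p → Inner (shrink p)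
    shrink-inside {p} p∈ i = begin
      edgeForm i (shrink p)  ≡⟨ edgeForm-shrink i ⟩
      ¼ * edgeForm i p       ≤⟨ ℚₚ.*-monoˡ-≤-nonNeg ¼ (p∈ i) ⟩
      ¼ * outer              ≡⟨⟩
      inner                  ∎
      where
      open ℚₚ.≤-Reasoning
      edgeForm-shrink : ∀ i → edgeForm i (shrink p) ≡ ¼ * edgeForm i p
      edgeForm-shrink zero             = scale-linear ¼ 0 -4 p
      edgeForm-shrink (suc zero)       = scale-linear ¼ -3 2 p
      edgeForm-shrink (suc (suc zero)) = scale-linear ¼ 3 2 p

    inner⊆outer : ∀ {p} → Inner p → Outer p
    inner⊆outer p∈ i = ℚₚ.≤-trans (p∈ i) (ℚₚ.≤ᵇ⇒≤ _)

  corner innerCorner : Fin 3 → Point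
  corner zero             = 0 , 1024
  corner (suc zero)       = -1024 , -512
  corner (suc (suc zero)) = 1024 , -512
  innerCorner zero             = 0 , 256
  innerCorner (suc zero)       = -256 , -128
  innerCorner (suc (suc zero)) = 256 , -128

  opaque
    unfolding ¼

    shrink-corner : ∀ i → shrink (corner i) ≡ innerCorner i
    shrink-corner zero             = refl
    shrink-corner (suc zero)       = refl
    shrink-corner (suc (suc zero)) = refl

module SegmentTests where

  open import Defs using (Point; OnSeg)
  open Segments
  open import Data.Rational using (ℚ; 0ℚ; _<_; _≤_)
  import Data.Rational.Properties as ℚₚ
  open import Data.Empty using (⊥; ⊥-elim)
  open import Data.Product using (_×_; _,_)
  open import Data.Sum using (_⊎_; inj₁; inj₂)
  open import Data.Unit using (⊤)
  open import Relation.Nullary using (Dec; yes; no; _×-dec_; _⊎-dec_; ¬?)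
  open import Relation.Unary using (Decidable)
  open import Relation.Binary.PropositionalEquality
  open import Data.Bool using (Bool; true; false; T)
  open import Data.List using (List; []; _∷_)
  open import Data.List.Membership.Propositional using (_∈_)
  open import Data.List.Relation.Unary.Any using (here; there)
  open import Function using (case_of_)

  Below : (Point → ℚ) → Point → Point → Point → Point → Set
  Below f a b c d = (f a < f c × f a < f d) × (f b < f c × f b < f d)

  below? : ∀ f a b c d → Dec (Below f a b c d)
  below? f a b c d = (f a ℚₚ.<? f c ×-dec f a ℚₚ.<? f d) ×-dec (f b ℚₚ.<? f c ×-dec f b ℚₚ.<? f d)

  below-disjoint : ∀ {f} → Affine f → ∀ a b c d → Below f a b c d →
                   ∀ p → OnSeg p a b → OnSeg p c d → ⊥
  below-disjoint f-affine a b c d ((ac , ad) , (bc , bd)) p o o′ =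
    ℚₚ.<-irrefl refl (affine-> f-affine p c d o′ (affine-< f-affine p a b o ac bc) (affine-< f-affine p a b o ad bd))

  StrictlySameSign : ℚ → ℚ → Set
  StrictlySameSign u v = (0ℚ < u × 0ℚ < v) ⊎ (u < 0ℚ × v < 0ℚ)

  strictlySameSign? : ∀ u v → Dec (StrictlySameSign u v)
  strictlySameSign? u v = (0ℚ ℚₚ.<? u ×-dec 0ℚ ℚₚ.<? v) ⊎-dec (u ℚₚ.<? 0ℚ ×-dec v ℚₚ.<? 0ℚ)

  sameSide-disjoint : ∀ a b c d → StrictlySameSign (side a b c) (side a b d) →
                      ∀ p → OnSeg p a b → OnSeg p c d → ⊥
  sameSide-disjoint a b c d signs p o o′ with signs | side-onSeg p a b o
  ... | inj₁ (0<c , 0<d) | p≡0 = ℚₚ.<-irrefl (sym p≡0) (affine-> (side-affine a b) p c d o′ 0<c 0<d)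
  ... | inj₂ (c<0 , d<0) | p≡0 = ℚₚ.<-irrefl p≡0 (affine-< (side-affine a b) p c d o′ c<0 d<0)

  Apart : Point → Point → Point → Point → Set
  Apart a b c d = Below X a b c d ⊎ Below X c d a b ⊎ Below Y a b c d ⊎ Below Y c d a b
                ⊎ StrictlySameSign (side a b c) (side a b d) ⊎ StrictlySameSign (side c d a) (side c d b)

  apart? : ∀ a b c d → Dec (Apart a b c d)
  apart? a b c d = below? X a b c d ⊎-dec below? X c d a b ⊎-dec below? Y a b c d ⊎-dec below? Y c d a b
                 ⊎-dec strictlySameSign? (side a b c) (side a b d) ⊎-dec strictlySameSign? (side c d a) (side c d b)

  apart-disjoint : ∀ a b c d → Apart a b c d → ∀ p → OnSeg p a b → OnSeg p c d → ⊥
  apart-disjoint a b c d (inj₁ below) p o o′ =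
    below-disjoint X-affine a b c d below p o o′
  apart-disjoint a b c d (inj₂ (inj₁ below)) p o o′ =
    below-disjoint X-affine c d a b below p o′ o
  apart-disjoint a b c d (inj₂ (inj₂ (inj₁ below))) p o o′ =
    below-disjoint Y-affine a b c d below p o o′
  apart-disjoint a b c d (inj₂ (inj₂ (inj₂ (inj₁ below)))) p o o′ =
    below-disjoint Y-affine c d a b below p o′ o
  apart-disjoint a b c d (inj₂ (inj₂ (inj₂ (inj₂ (inj₁ signs))))) p o o′ =
    sameSide-disjoint a b c d signs p o o′
  apart-disjoint a b c d (inj₂ (inj₂ (inj₂ (inj₂ (inj₂ signs))))) p o o′ =
    sameSide-disjoint c d a b signs p o′ o

  module _ (End : Point → Set) where

    MeetsHalfPlaneAtEnd : (Point → ℚ) → ℚ → Point → Point → Set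
    MeetsHalfPlaneAtEnd f c a b =
      (c < f a × c < f b) ⊎ (f a ≡ c × c < f b × End a) ⊎ (f b ≡ c × c < f a × End b)

    private
      at-start : ∀ {f} → Affine f → ∀ {c} a b → f a ≡ c → c < f b → End a →
                 ∀ p → OnSeg p a b → f p ≤ c → End p
      at-start {f} f-affine a b fa≡c c<fb a∈ p o fp≤c = subst End (sym p≡a) a∈
        where
        fp≡fa : f p ≡ f a
        fp≡fa = trans (ℚₚ.≤-antisym fp≤c (affine-≥ f-affine p a b o (ℚₚ.≤-reflexive (sym fa≡c)) (ℚₚ.<⇒≤ c<fb)))
                      (sym fa≡c)
        p≡a : p ≡ a
        p≡a = affine-injective f-affine p a a b (λ fb≡fa → ℚₚ.<-irrefl (trans (sym fa≡c) (sym fb≡fa)) c<fb)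
                o (onSeg-start a b) fp≡fa

    meetsHalfPlaneAtEnd-sound : ∀ {f} → Affine f → ∀ c a b → MeetsHalfPlaneAtEnd f c a b →
                                ∀ p → OnSeg p a b → f p ≤ c → End p
    meetsHalfPlaneAtEnd-sound f-affine c a b (inj₁ (c<fa , c<fb)) p o fp≤c =
      ⊥-elim (ℚₚ.<-irrefl refl (ℚₚ.<-≤-trans (affine-> f-affine p a b o c<fa c<fb) fp≤c))
    meetsHalfPlaneAtEnd-sound f-affine c a b (inj₂ (inj₁ (fa≡c , c<fb , a∈))) p o fp≤c =
      at-start f-affine a b fa≡c c<fb a∈ p o fp≤c
    meetsHalfPlaneAtEnd-sound f-affine c a b (inj₂ (inj₂ (fb≡c , c<fa , b∈))) p o fp≤c =
      at-start f-affine b a fb≡c c<fa b∈ p (onSeg-reverse p a b o) fp≤c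

  meetsHalfPlaneAtEnd? : ∀ {End} → Decidable End → ∀ f c a b → Dec (MeetsHalfPlaneAtEnd End f c a b)
  meetsHalfPlaneAtEnd? end? f c a b =
          (c ℚₚ.<? f a ×-dec c ℚₚ.<? f b)
    ⊎-dec (f a ℚₚ.≟ c ×-dec c ℚₚ.<? f b ×-dec end? a)
    ⊎-dec (f b ℚₚ.≟ c ×-dec c ℚₚ.<? f a ×-dec end? b)

  data Verdict : Set where
    avoiding crossing unknown : Verdict

  module _ (Vertex : Point → Set) where

    Touches : Point → Point → Point → Point → Set
    Touches a b c d = (side a b c ≡ 0ℚ × side a b d ≢ 0ℚ × Vertex c)
                    ⊎ (side a b d ≡ 0ℚ × side a b c ≢ 0ℚ × Vertex d)

    touches-vertex : ∀ a b c d → Touches a b c d → ∀ p → OnSeg p a b → OnSeg p c d → Vertex p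
    touches-vertex a b c d (inj₁ (c≡0 , d≢0 , c∈)) p o o′ =
      subst Vertex (sym (affine-injective (side-affine a b) p c c d (λ d≡c → d≢0 (trans d≡c c≡0))
        o′ (onSeg-start c d) (trans (side-onSeg p a b o) (sym c≡0)))) c∈
    touches-vertex a b c d (inj₂ (d≡0 , c≢0 , d∈)) p o o′ =
      subst Vertex (sym (affine-injective (side-affine a b) p d d c (λ c≡d → c≢0 (trans c≡d d≡0))
        (onSeg-reverse p c d o′) (onSeg-start d c) (trans (side-onSeg p a b o) (sym d≡0)))) d∈

    Avoid : Point → Point → Point → Point → Set
    Avoid a b c d = Apart a b c d ⊎ Touches a b c d ⊎ Touches c d a b

    Meaning : Verdict → Point → Point → Point → Point → Set
    Meaning avoiding a b c d = ∀ p → OnSeg p a b → OnSeg p c d → Vertex p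
    Meaning crossing a b c d = ∀ p q → OnSeg p a b → OnSeg p c d → OnSeg q a b → OnSeg q c d → p ≡ q
    Meaning unknown  a b c d = ⊤

  module _ {Vertex : Point → Set} (vertex? : Decidable Vertex) where

    touches? : ∀ a b c d → Dec (Touches Vertex a b c d)
    touches? a b c d = (side a b c ℚₚ.≟ 0ℚ ×-dec ¬? (side a b d ℚₚ.≟ 0ℚ) ×-dec vertex? c)
                ⊎-dec (side a b d ℚₚ.≟ 0ℚ ×-dec ¬? (side a b c ℚₚ.≟ 0ℚ) ×-dec vertex? d)

    avoid? : ∀ a b c d → Dec (Avoid Vertex a b c d)
    avoid? a b c d = apart? a b c d ⊎-dec touches? a b c d ⊎-dec touches? c d a b

    -- side a b vanishes at every common point and is affine on [c,d]; if it is not constant there,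
    -- the segments share at most one point.
    classify : Point → Point → Point → Point → Verdict
    classify a b c d with avoid? a b c d | side a b d ℚₚ.≟ side a b c
    ... | yes _ | _     = avoiding
    ... | no _  | no _  = crossing
    ... | no _  | yes _ = unknown

    classify-sound : ∀ a b c d → Meaning Vertex (classify a b c d) a b c d
    classify-sound a b c d with avoid? a b c d | side a b d ℚₚ.≟ side a b c
    ... | yes (inj₁ apart)        | _ = λ p o o′ → ⊥-elim (apart-disjoint a b c d apart p o o′)
    ... | yes (inj₂ (inj₁ touch)) | _ = touches-vertex Vertex a b c d touch
    ... | yes (inj₂ (inj₂ touch)) | _ = λ p o o′ → touches-vertex Vertex c d a b touch p o′ o
    ... | no _ | no d≢c = λ p q o o′ u u′ →
      affine-injective (side-affine a b) p q c d d≢c o′ u′ (trans (side-onSeg p a b o) (sym (side-onSeg q a b u)))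
    ... | no _ | yes _ = _

  module _ {A : Set} (verdict : A → Verdict) where

    allAvoiding : List A → Bool
    allAvoiding []      = true
    allAvoiding (x ∷ l) with verdict x
    ... | avoiding = allAvoiding l
    ... | _        = false

    atMostOneCrossing : List A → Bool
    atMostOneCrossing []      = true
    atMostOneCrossing (x ∷ l) with verdict x
    ... | avoiding = atMostOneCrossing l
    ... | crossing = allAvoiding l
    ... | unknown  = false

    allAvoiding-sound : ∀ {x l} → T (allAvoiding l) → x ∈ l → verdict x ≡ avoiding
    allAvoiding-sound {l = y ∷ l} ok x∈ with verdict y in eq | x∈
    ... | avoiding | here refl = eq
    ... | avoiding | there x∈l = allAvoiding-sound ok x∈l

    atMostOneCrossing-known : ∀ {x l} → T (atMostOneCrossing l) → x ∈ l → verdict x ≢ unknown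
    atMostOneCrossing-known {l = y ∷ l} ok x∈ with verdict y in eq | x∈
    ... | avoiding | here refl = λ x-unknown → case trans (sym eq) x-unknown of λ ()
    ... | avoiding | there x∈l = atMostOneCrossing-known ok x∈l
    ... | crossing | here refl = λ x-unknown → case trans (sym eq) x-unknown of λ ()
    ... | crossing | there x∈l = λ x-unknown → case trans (sym (allAvoiding-sound ok x∈l)) x-unknown of λ ()

    atMostOneCrossing-unique : ∀ {x y l} → T (atMostOneCrossing l) → x ∈ l → y ∈ l →
                               verdict x ≡ crossing → verdict y ≡ crossing → x ≡ y
    atMostOneCrossing-unique {l = z ∷ l} ok x∈ y∈ x× y× with verdict z in eq | x∈ | y∈
    ... | avoiding | here refl | _         = case trans (sym eq) x× of λ ()
    ... | avoiding | there _   | here refl = case trans (sym eq) y× of λ ()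
    ... | avoiding | there x∈l | there y∈l = atMostOneCrossing-unique ok x∈l y∈l x× y×
    ... | crossing | here refl | here refl = refl
    ... | crossing | there x∈l | _         = case trans (sym (allAvoiding-sound ok x∈l)) x× of λ ()
    ... | crossing | here refl | there y∈l = case trans (sym (allAvoiding-sound ok y∈l)) y× of λ ()

module UnorderedPairs where

  open import Data.Product using (_×_; _,_)
  open import Data.Sum using (_⊎_; inj₁; inj₂; [_,_]′)
  open import Function using (Injective)
  open import Relation.Binary.PropositionalEquality

  Unordered : {A : Set} → A → A → A → A → Set
  Unordered u v x y = (u ≡ x × v ≡ y) ⊎ (u ≡ y × v ≡ x)

  module _ {A : Set} where

    unordered-sym : {u v x y : A} → Unordered u v x y → Unordered x y u v
    unordered-sym (inj₁ (refl , refl)) = inj₁ (refl , refl)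
    unordered-sym (inj₂ (refl , refl)) = inj₂ (refl , refl)

    unordered-trans : {u v x y a b : A} → Unordered u v x y → Unordered x y a b → Unordered u v a b
    unordered-trans (inj₁ (refl , refl)) xy~ab                = xy~ab
    unordered-trans (inj₂ (refl , refl)) (inj₁ (refl , refl)) = inj₂ (refl , refl)
    unordered-trans (inj₂ (refl , refl)) (inj₂ (refl , refl)) = inj₁ (refl , refl)

    unordered-ends : {B : Set} (f : A → B) {u v x y : A} {z : B} → Unordered u v x y →
                     z ≡ f x ⊎ z ≡ f y → z ≡ f u ⊎ z ≡ f v
    unordered-ends f (inj₁ (refl , refl)) z≡ = z≡
    unordered-ends f (inj₂ (refl , refl)) z≡ = [ inj₂ , inj₁ ]′ z≡

    unordered-map : {B : Set} (f : A → B) {u v x y : A} → Unordered u v x y → Unordered (f u) (f v) (f x) (f y)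
    unordered-map f (inj₁ (refl , refl)) = inj₁ (refl , refl)
    unordered-map f (inj₂ (refl , refl)) = inj₂ (refl , refl)

    unordered-unmap : {B : Set} {f : A → B} → Injective _≡_ _≡_ f → {u v x y : A} →
                      Unordered (f u) (f v) (f x) (f y) → Unordered u v x y
    unordered-unmap f-inj (inj₁ (fu≡fx , fv≡fy)) = inj₁ (f-inj fu≡fx , f-inj fv≡fy)
    unordered-unmap f-inj (inj₂ (fu≡fy , fv≡fx)) = inj₂ (f-inj fu≡fy , f-inj fv≡fx)

module CertifiedDrawing where

  open import Defs hiding (sym)
  open Segments
  open Polylines
  open SegmentTests
  open UnorderedPairs
  open Triangles using (InTriangle; inTriangle?; edgeForm; edgeForm-affine; inTriangle-onSeg)
  open import Data.Bool using (true; T)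
  open import Data.Bool.Properties using (∨-comm; T-≡)
  open import Data.Empty using (⊥-elim)
  open import Data.Fin as Fin using (Fin; _<_)
  open import Data.Fin.Properties as Finₚ using (<-cmp; <-irrefl)
  open import Data.List using (List; []; _∷_; _++_; [_]; reverse; map; concatMap; filter)
  open import Data.List.Properties using (reverse-involutive; unfold-reverse; reverse-++)
  open import Data.List.Membership.Propositional using (_∈_; lose)
  open import Data.List.Membership.Propositional.Properties using (∈-map⁺; ∈-concatMap⁺; ∈-filter⁺)
  open import Data.List.Relation.Unary.All as All using (All)
  open import Data.Nat using (ℕ)
  open import Data.Product using (∃; _×_; _,_; proj₁; proj₂)
  open import Data.Product.Properties using (≡-dec)
  open import Data.Rational using (ℚ)
  import Data.Rational.Properties as ℚₚ
  open import Data.Sum using (_⊎_; inj₁; inj₂; [_,_]′)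
  open import Function using (Equivalence)
  open import Relation.Binary using (DecidableEquality; tri<; tri≈; tri>)
  open import Relation.Binary.PropositionalEquality hiding ([_])
  open import Relation.Nullary using (Dec; ¬_; ¬?; _⊎-dec_; _×-dec_)
  open import Relation.Nullary.Decidable using (toWitness; dec-false; isYes≗does)
  open import Relation.Unary using (Decidable)

  _≟ₚ_ : DecidableEquality Point
  _≟ₚ_ = ≡-dec ℚₚ._≟_ ℚₚ._≟_

  module Certificate {N : ℕ} (E : List (Fin N × Fin N)) (P : Fin N → Point)
                     (B : Fin N → Fin N → List Point) where

    Edge : Set
    Edge = Fin N × Fin N

    _≟ₑ_ : DecidableEquality Edge
    _≟ₑ_ = ≡-dec Fin._≟_ Fin._≟_

    open import Data.List.Membership.DecPropositional _≟ₑ_ using (_∈?_)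

    Adjacent : Fin N → Fin N → Set
    Adjacent u v = (u , v) ∈ E ⊎ (v , u) ∈ E

    adjacent? : ∀ u v → Dec (Adjacent u v)
    adjacent? u v = ((u , v) ∈? E) ⊎-dec ((v , u) ∈? E)

    -- E lists each edge once, as (u , v) with u < v, and B u v are its bends from P u to P v.
    bends : Fin N → Fin N → List Point
    bends u v with <-cmp u v
    ... | tri< _ _ _ = B u v
    ... | tri≈ _ _ _ = []
    ... | tri> _ _ _ = reverse (B v u)

    edgeCurve : Edge → List Point
    edgeCurve (u , v) = P u ∷ (B u v ++ [ P v ])

    IsVertex : Point → Set
    IsVertex z = ∃ λ w → P w ≡ z

    isVertex? : Decidable IsVertex
    isVertex? z = Finₚ.any? (λ w → P w ≟ₚ z)

    Ordered : Set
    Ordered = All (λ e → proj₁ e < proj₂ e) E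

    ordered? : Dec Ordered
    ordered? = All.all? (λ e → proj₁ e Finₚ.<? proj₂ e) E

    DistinctPositions : Set
    DistinctPositions = ∀ u v → u ≡ v ⊎ P u ≢ P v

    distinctPositions? : Dec DistinctPositions
    distinctPositions? = Finₚ.all? λ u → Finₚ.all? λ v → (u Fin.≟ v) ⊎-dec ¬? (P u ≟ₚ P v)

    -- A vertex is tested against a segment as the degenerate segment from P w to P w.
    AvoidsVertices : Edge → Set
    AvoidsVertices e = ∀ w → w ≡ proj₁ e ⊎ w ≡ proj₂ e
                           ⊎ All (λ s → Apart (P w) (P w) (proj₁ s) (proj₂ s)) (segments (edgeCurve e))

    avoidsVertices? : ∀ e → Dec (AvoidsVertices e)
    avoidsVertices? e = Finₚ.all? λ w → (w Fin.≟ proj₁ e) ⊎-dec (w Fin.≟ proj₂ e)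
      ⊎-dec All.all? (λ s → apart? (P w) (P w) (proj₁ s) (proj₂ s)) (segments (edgeCurve e))

    Candidate : Set
    Candidate = Edge × (Point × Point) × (Point × Point)

    candidates : Edge → List Candidate
    candidates e = concatMap (λ f → concatMap (λ σ → map (λ τ → f , σ , τ) (segments (edgeCurve f)))
                                               (segments (edgeCurve e)))
                             (filter (λ f → ¬? (f ≟ₑ e)) E)

    verdict : Candidate → Verdict
    verdict (_ , (a , b) , (c , d)) = classify isVertex? a b c d

    CrossedAtMostOnce : Edge → Set
    CrossedAtMostOnce e = T (atMostOneCrossing verdict (candidates e))

    Planar1 : Set
    Planar1 = Ordered × DistinctPositions × All AvoidsVertices E × All CrossedAtMostOnce E

    planar1? : Dec Planar1
    planar1? = ordered? ×-dec distinctPositions? ×-dec All.all? avoidsVertices? E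
                        ×-dec All.all? (λ e → T? (atMostOneCrossing verdict (candidates e))) E
      where open import Relation.Nullary.Decidable using (T?)

    curve : Fin N → Fin N → List Point
    curve u v = P u ∷ (bends u v ++ [ P v ])

    private
      bends-< : ∀ {u v} → u < v → bends u v ≡ B u v
      bends-< {u} {v} u<v with <-cmp u v
      ... | tri< _ _ _    = refl
      ... | tri≈ u≮v _ _  = ⊥-elim (u≮v u<v)
      ... | tri> u≮v _ _  = ⊥-elim (u≮v u<v)

      bends-> : ∀ {u v} → v < u → bends u v ≡ reverse (B v u)
      bends-> {u} {v} v<u with <-cmp u v
      ... | tri< _ _ v≮u  = ⊥-elim (v≮u v<u)
      ... | tri≈ _ _ v≮u  = ⊥-elim (v≮u v<u)
      ... | tri> _ _ _    = refl

      bends-≡ : ∀ u → bends u u ≡ []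
      bends-≡ u with <-cmp u u
      ... | tri< u<u _ _ = ⊥-elim (<-irrefl refl u<u)
      ... | tri≈ _ _ _   = refl
      ... | tri> _ _ u<u = ⊥-elim (<-irrefl refl u<u)

    bends-sym : ∀ u v → bends v u ≡ reverse (bends u v)
    bends-sym u v with <-cmp u v
    ... | tri< u<v _ _  = bends-> u<v
    ... | tri≈ _ refl _ = bends-≡ u
    ... | tri> _ _ v<u  = trans (bends-< v<u) (sym (reverse-involutive (B v u)))

    private
      reverse-edgeCurve : ∀ u v → reverse (edgeCurve (v , u)) ≡ P u ∷ (reverse (B v u) ++ [ P v ])
      reverse-edgeCurve u v = begin
        reverse (P v ∷ (B v u ++ [ P u ]))   ≡⟨ unfold-reverse (P v) (B v u ++ [ P u ]) ⟩
        reverse (B v u ++ [ P u ]) ++ [ P v ] ≡⟨ cong (_++ [ P v ]) (reverse-++ (B v u) [ P u ]) ⟩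
        P u ∷ (reverse (B v u) ++ [ P v ])   ∎
        where open ≡-Reasoning

    CurvesInside : ℚ → Set
    CurvesInside c = All (λ e → All (InTriangle c) (edgeCurve e)) E

    curvesInside? : ∀ c → Dec (CurvesInside c)
    curvesInside? c = All.all? (λ e → All.all? (inTriangle? c) (edgeCurve e)) E

    IsEndOf : Edge → Point → Set
    IsEndOf e z = z ≡ P (proj₁ e) ⊎ z ≡ P (proj₂ e)

    isEndOf? : ∀ e → Decidable (IsEndOf e)
    isEndOf? e z = (z ≟ₚ P (proj₁ e)) ⊎-dec (z ≟ₚ P (proj₂ e))

    CurvesExit : ℚ → Set
    CurvesExit c = All (λ e → All (λ s → ∃ λ i → MeetsHalfPlaneAtEnd (IsEndOf e) (edgeForm i) c (proj₁ s) (proj₂ s))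
                                 (segments (edgeCurve e))) E

    curvesExit? : ∀ c → Dec (CurvesExit c)
    curvesExit? c = All.all? (λ e → All.all? (λ s → Finₚ.any? λ i →
                      meetsHalfPlaneAtEnd? (isEndOf? e) (edgeForm i) c (proj₁ s) (proj₂ s)) (segments (edgeCurve e))) E

    module Sound (certified : Planar1) where

      private
        ordered  = proj₁ certified
        distinct = proj₁ (proj₂ certified)
        avoids   = proj₁ (proj₂ (proj₂ certified))
        crossed  = proj₂ (proj₂ (proj₂ certified))

      no-loop : ∀ v → ¬ Adjacent v v
      no-loop v = [ loop , loop ]′
        where loop : (v , v) ∈ E → _
              loop vv∈ = <-irrefl refl (All.lookup ordered vv∈)

      graph : SimpleGraph N
      graph = record
        { Adj    = λ u v → Dec.does (adjacent? u v)
        ; sym    = λ u v → ∨-comm (Dec.does ((u , v) ∈? E)) (Dec.does ((v , u) ∈? E))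
        ; irrefl = λ v → dec-false (adjacent? v v) (no-loop v)
        }
        where import Relation.Nullary.Decidable as Dec

      adjacent : ∀ {u v} → Adj graph u v ≡ true → Adjacent u v
      adjacent {u} {v} uv = toWitness (Equivalence.from T-≡ (trans (isYes≗does (adjacent? u v)) uv))

      canonical : ∀ {u v} → Adjacent u v →
                  ∃ λ e → e ∈ E × SamePair u v (proj₁ e) (proj₂ e)
                        × (∀ p → OnPath p (curve u v) → OnPath p (edgeCurve e))
      canonical {u} {v} (inj₁ uv∈) =
        (u , v) , uv∈ , inj₁ (refl , refl) ,
        λ p → subst (OnPath p) (cong (λ l → P u ∷ (l ++ [ P v ])) (bends-< (All.lookup ordered uv∈)))
      canonical {u} {v} (inj₂ vu∈) =
        (v , u) , vu∈ , inj₂ (refl , refl) ,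
        λ p o → onPath-reverse⁻ (edgeCurve (v , u))
                  (subst (OnPath p) (trans (cong (λ l → P u ∷ (l ++ [ P v ])) (bends-> (All.lookup ordered vu∈)))
                                           (sym (reverse-edgeCurve u v))) o)

      pos-injective : ∀ u v → P u ≡ P v → u ≡ v
      pos-injective u v Pu≡Pv = [ (λ u≡v → u≡v) , (λ Pu≢Pv → ⊥-elim (Pu≢Pv Pu≡Pv)) ]′ (distinct u v)

      avoid-verts : ∀ u v w → Adj graph u v ≡ true → OnPath (P w) (curve u v) → w ≡ u ⊎ w ≡ v
      avoid-verts u v w uv on with canonical (adjacent uv)
      ... | e , e∈ , uv~e , ⊇e with All.lookup avoids e∈ w
      ... | inj₁ w≡e₁          = unordered-ends (λ w → w) uv~e (inj₁ w≡e₁)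
      ... | inj₂ (inj₁ w≡e₂)   = unordered-ends (λ w → w) uv~e (inj₂ w≡e₂)
      ... | inj₂ (inj₂ apart) with onPath⇒onSegment (edgeCurve e) (⊇e (P w) on)
      ... | (a , b) , s∈ , on-ab =
        ⊥-elim (apart-disjoint (P w) (P w) a b (All.lookup apart s∈) (P w) (onSeg-start (P w) (P w)) on-ab)

      private
        candidate∈ : ∀ {e f σ τ} → f ∈ E → f ≢ e → σ ∈ segments (edgeCurve e) → τ ∈ segments (edgeCurve f) →
                     (f , σ , τ) ∈ candidates e
        candidate∈ {e} {f} {σ} f∈ f≢e σ∈ τ∈ =
          ∈-concatMap⁺ (λ f → concatMap (λ σ → map (λ τ → f , σ , τ) (segments (edgeCurve f)))
                                        (segments (edgeCurve e)))
            (lose (∈-filter⁺ (λ f → ¬? (f ≟ₑ e)) f∈ f≢e)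
              (∈-concatMap⁺ (λ σ → map (λ τ → f , σ , τ) (segments (edgeCurve f)))
                (lose σ∈ (∈-map⁺ (λ τ → f , σ , τ) τ∈))))

        interior-verdict : ∀ a b c d p → OnSeg p a b → OnSeg p c d → ¬ IsVertex p →
                           classify isVertex? a b c d ≢ unknown → classify isVertex? a b c d ≡ crossing
        interior-verdict a b c d p o o′ interior known
          with classify isVertex? a b c d | classify-sound isVertex? a b c d
        ... | avoiding | meets = ⊥-elim (interior (meets p o o′))
        ... | crossing | _     = refl
        ... | unknown  | _     = ⊥-elim (known refl)

        crossing-meaning : ∀ a b c d → classify isVertex? a b c d ≡ crossing → Meaning IsVertex crossing a b c d
        crossing-meaning a b c d c× = subst (λ v → Meaning IsVertex v a b c d) c× (classify-sound isVertex? a b c d)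

      CrossingOf : Edge → Fin N → Fin N → Point → Set
      CrossingOf e x y p = ∃ λ (c : Candidate) → let (f , (a , b) , (c′ , d)) = c in
        c ∈ candidates e × verdict c ≡ crossing × SamePair x y (proj₁ f) (proj₂ f) × OnSeg p a b × OnSeg p c′ d

      crossing-of : ∀ {e x y p} → e ∈ E → OnPath p (edgeCurve e) → ¬ IsVertex p →
                    Adjacent x y → ¬ SamePair (proj₁ e) (proj₂ e) x y → OnPath p (curve x y) → CrossingOf e x y p
      crossing-of {e} {p = p} e∈ on-e interior xy e≁xy on-xy with canonical xy
      ... | f , f∈ , xy~f , ⊇f with onPath⇒onSegment (edgeCurve e) on-e | onPath⇒onSegment (edgeCurve f) (⊇f p on-xy)
      ... | (a , b) , σ∈ , on-σ | (c , d) , τ∈ , on-τ =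
        (f , (a , b) , (c , d)) , c∈ ,
        interior-verdict a b c d p on-σ on-τ interior (atMostOneCrossing-known verdict (All.lookup crossed e∈) c∈) ,
        xy~f , on-σ , on-τ
        where
        f≢e : f ≢ e
        f≢e refl = e≁xy (unordered-sym xy~f)
        c∈ = candidate∈ f∈ f≢e σ∈ τ∈

      crossings-agree : ∀ {e x y x′ y′ p q} → e ∈ E → CrossingOf e x y p → CrossingOf e x′ y′ q →
                        p ≡ q × SamePair x y x′ y′
      crossings-agree {p = p} {q} e∈ ((f , (a , b) , (c , d)) , c∈ , c× , xy~f , on-σ , on-τ)
                                     (c′ , c′∈ , c′× , x′y′~f , on-σ′ , on-τ′)
        with atMostOneCrossing-unique verdict (All.lookup crossed e∈) c∈ c′∈ c× c′×
      ... | refl = crossing-meaning a b c d c× p q on-σ on-τ on-σ′ on-τ′ ,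
                   unordered-trans xy~f (unordered-sym x′y′~f)

      one-crossing : ∀ u v x y x′ y′ p q → Adj graph u v ≡ true → Adj graph x y ≡ true → Adj graph x′ y′ ≡ true →
        ¬ SamePair u v x y → ¬ SamePair u v x′ y′ →
        OnPath p (curve u v) × (∀ w → ¬ p ≡ P w) → OnPath p (curve x y) →
        OnPath q (curve u v) × (∀ w → ¬ q ≡ P w) → OnPath q (curve x′ y′) →
        (p ≡ q) × SamePair x y x′ y′
      one-crossing u v x y x′ y′ p q uv xy x′y′ uv≁xy uv≁x′y′ (on-uv , p-int) on-xy (on-uv′ , q-int) on-x′y′ =
        let e , e∈ , uv~e , ⊇e = canonical (adjacent uv) in
        crossings-agree e∈
          (crossing-of e∈ (⊇e p on-uv) (λ (w , Pw≡p) → p-int w (sym Pw≡p)) (adjacent xy)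
                       (λ e~xy → uv≁xy (unordered-trans uv~e e~xy)) on-xy)
          (crossing-of e∈ (⊇e q on-uv′) (λ (w , Pw≡q) → q-int w (sym Pw≡q)) (adjacent x′y′)
                       (λ e~x′y′ → uv≁x′y′ (unordered-trans uv~e e~x′y′)) on-x′y′)

      drawing : OnePlanarDrawing graph
      drawing = record
        { pos          = P
        ; bends        = bends
        ; pos-inj      = pos-injective
        ; bends-sym    = bends-sym
        ; avoid-verts  = avoid-verts
        ; one-crossing = one-crossing
        }

      curve-inside : ∀ {c} → CurvesInside c → ∀ u v → Adj graph u v ≡ true →
                     ∀ p → OnPath p (curve u v) → InTriangle c p
      curve-inside inside u v uv p on with canonical (adjacent uv)
      ... | e , e∈ , _ , ⊇e with onPath⇒onSegment (edgeCurve e) (⊇e p on)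
      ... | (a , b) , s∈ , on-ab with segment-ends (edgeCurve e) s∈
      ... | a∈ , b∈ = inTriangle-onSeg p a b on-ab (All.lookup inside-e a∈) (All.lookup inside-e b∈)
        where inside-e = All.lookup inside e∈

      curve-exits : ∀ {c} → CurvesExit c → ∀ u v → Adj graph u v ≡ true → ∀ p → OnPath p (curve u v) →
                    InTriangle c p → p ≡ P u ⊎ p ≡ P v
      curve-exits {c} exits u v uv p on p∈ with canonical (adjacent uv)
      ... | e , e∈ , uv~e , ⊇e with onPath⇒onSegment (edgeCurve e) (⊇e p on)
      ... | (a , b) , s∈ , on-ab with All.lookup (All.lookup exits e∈) s∈
      ... | i , exit =
        unordered-ends P uv~e (meetsHalfPlaneAtEnd-sound (IsEndOf e) (edgeForm-affine i) c a b exit p on-ab (p∈ i))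

module Nesting where

  open import Defs hiding (sym)
  open Scaling using (shrink; grow; shrink-injective; grow-injective; grow-shrink; shrink-grow; grow-onPath)
  open Triangles using (Outer; Inner; corner; shrink-inside; inner⊆outer)
  open UnorderedPairs
  open import Data.Bool using (Bool; true; false)
  open import Data.Empty using (⊥-elim)
  open import Data.Fin using (Fin; zero; suc; _↑ˡ_; _↑ʳ_; splitAt; join)
  open import Data.Fin.Properties
    using (↑ˡ-injective; splitAt-join; join-splitAt; splitAt-↑ˡ; splitAt-↑ʳ; splitAt⁻¹-↑ˡ; splitAt⁻¹-↑ʳ)
  open import Data.List using (List; []; _∷_; _++_; [_]; reverse; map)
  open import Data.List.Properties using (map-++; reverse-map)
  open import Data.Nat using (ℕ; _+_)
  open import Data.Product using (∃₂; _×_; _,_)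
  open import Data.Sum using (_⊎_; inj₁; inj₂; [_,_]′) renaming (map to map⊎)
  open import Function using (_∘_; id)
  open import Relation.Nullary using (¬_)
  open import Relation.Binary.PropositionalEquality hiding ([_])

  record Framed (m : ℕ) : Set where
    field
      graph   : SimpleGraph (3 + m)
      drawing : OnePlanarDrawing graph
    open OnePlanarDrawing drawing public
    field
      corners-at      : ∀ i → pos (i ↑ˡ m) ≡ corner i
      vertices-inside : ∀ v → Outer (pos v)
      edges-inside    : ∀ u v → Adj graph u v ≡ true → ∀ p → OnPath p (curve u v) → Outer p

  record Collar (g : ℕ) : Set where
    field
      graph   : SimpleGraph (g + 3)
      drawing : OnePlanarDrawing graph
    open OnePlanarDrawing drawing public
    field
      inner-corners-at : ∀ i → pos (g ↑ʳ i) ≡ shrink (corner i)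
      vertices-inside  : ∀ v → Outer (pos v)
      edges-inside     : ∀ u v → Adj graph u v ≡ true → ∀ p → OnPath p (curve u v) → Outer p
      edges-exit-inner : ∀ u v → Adj graph u v ≡ true → ∀ p → OnPath p (curve u v) → Inner p → p ≡ pos u ⊎ p ≡ pos v
      new-outside      : ∀ a → ¬ Inner (pos (a ↑ˡ 3))

  module Nest {g m : ℕ} (C : Collar g) (F : Framed m) where

    private
      module C = Collar C
      module F = Framed F

    -- The new vertices of the collar, then the corners of the framed drawing (glued to the inner
    -- corners of the collar) and its remaining vertices.
    Vertex : Set
    Vertex = Fin g ⊎ (Fin 3 ⊎ Fin m)

    old : Fin 3 ⊎ Fin m → Fin (3 + m)
    old = join 3 m

    old-injective : ∀ {o o′} → old o ≡ old o′ → o ≡ o′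
    old-injective {o} {o′} eq = trans (sym (splitAt-join 3 m o)) (trans (cong (splitAt 3) eq) (splitAt-join 3 m o′))

    collarVertex : Fin (g + 3) → Vertex
    collarVertex c = [ inj₁ , inj₂ ∘ inj₁ ]′ (splitAt g c)

    collarVertex-new : ∀ a → collarVertex (a ↑ˡ 3) ≡ inj₁ a
    collarVertex-new a = cong [ inj₁ , inj₂ ∘ inj₁ ]′ (splitAt-↑ˡ g a 3)

    collarVertex-corner : ∀ i → collarVertex (g ↑ʳ i) ≡ inj₂ (inj₁ i)
    collarVertex-corner i = cong [ inj₁ , inj₂ ∘ inj₁ ]′ (splitAt-↑ʳ g 3 i)

    private
      adjC = Adj C.graph
      adjF = Adj F.graph

    adj : Vertex → Vertex → Bool
    adj (inj₂ o)         (inj₂ o′)        = adjF (old o) (old o′)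
    adj (inj₁ a)         (inj₁ b)         = adjC (a ↑ˡ 3) (b ↑ˡ 3)
    adj (inj₁ a)         (inj₂ (inj₁ i))  = adjC (a ↑ˡ 3) (g ↑ʳ i)
    adj (inj₁ a)         (inj₂ (inj₂ w))  = false
    adj (inj₂ (inj₁ i))  (inj₁ b)         = adjC (g ↑ʳ i) (b ↑ˡ 3)
    adj (inj₂ (inj₂ w))  (inj₁ b)         = false

    pos : Vertex → Point
    pos (inj₁ a) = C.pos (a ↑ˡ 3)
    pos (inj₂ o) = shrink (F.pos (old o))

    bends : Vertex → Vertex → List Point
    bends (inj₂ o)         (inj₂ o′)        = map shrink (F.bends (old o) (old o′))
    bends (inj₁ a)         (inj₁ b)         = C.bends (a ↑ˡ 3) (b ↑ˡ 3)
    bends (inj₁ a)         (inj₂ (inj₁ i))  = C.bends (a ↑ˡ 3) (g ↑ʳ i)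
    bends (inj₁ a)         (inj₂ (inj₂ w))  = []
    bends (inj₂ (inj₁ i))  (inj₁ b)         = C.bends (g ↑ʳ i) (b ↑ˡ 3)
    bends (inj₂ (inj₂ w))  (inj₁ b)         = []

    curve : Vertex → Vertex → List Point
    curve s t = pos s ∷ (bends s t ++ [ pos t ])

    pos-corner : ∀ i → pos (inj₂ (inj₁ i)) ≡ C.pos (g ↑ʳ i)
    pos-corner i = trans (cong shrink (F.corners-at i)) (sym (C.inner-corners-at i))

    pos-collarVertex : ∀ c → pos (collarVertex c) ≡ C.pos c
    pos-collarVertex c with splitAt g c in eq
    ... | inj₁ a = cong C.pos (splitAt⁻¹-↑ˡ eq)
    ... | inj₂ i = trans (pos-corner i) (cong C.pos (splitAt⁻¹-↑ʳ eq))

    old-inner : ∀ o → Inner (pos (inj₂ o))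
    old-inner o = shrink-inside (F.vertices-inside (old o))

    pos-injective : ∀ s t → pos s ≡ pos t → s ≡ t
    pos-injective (inj₁ a) (inj₁ b) eq = cong inj₁ (↑ˡ-injective 3 a b (C.pos-inj _ _ eq))
    pos-injective (inj₁ a) (inj₂ o) eq = ⊥-elim (C.new-outside a (subst Inner (sym eq) (old-inner o)))
    pos-injective (inj₂ o) (inj₁ b) eq = ⊥-elim (C.new-outside b (subst Inner eq (old-inner o)))
    pos-injective (inj₂ o) (inj₂ o′) eq = cong inj₂ (old-injective (F.pos-inj _ _ (shrink-injective eq)))

    adj-sym : ∀ s t → adj s t ≡ adj t s
    adj-sym (inj₂ o)         (inj₂ o′)        = SimpleGraph.sym F.graph _ _
    adj-sym (inj₁ a)         (inj₁ b)         = SimpleGraph.sym C.graph _ _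
    adj-sym (inj₁ a)         (inj₂ (inj₁ i))  = SimpleGraph.sym C.graph _ _
    adj-sym (inj₁ a)         (inj₂ (inj₂ w))  = refl
    adj-sym (inj₂ (inj₁ i))  (inj₁ b)         = SimpleGraph.sym C.graph _ _
    adj-sym (inj₂ (inj₂ w))  (inj₁ b)         = refl

    adj-irrefl : ∀ s → adj s s ≡ false
    adj-irrefl (inj₁ a) = SimpleGraph.irrefl C.graph _
    adj-irrefl (inj₂ o) = SimpleGraph.irrefl F.graph _

    bends-sym : ∀ s t → bends t s ≡ reverse (bends s t)
    bends-sym (inj₂ o)         (inj₂ o′)        =
      trans (cong (map shrink) (F.bends-sym _ _)) (reverse-map shrink (F.bends (old o) (old o′)))
    bends-sym (inj₁ a)         (inj₁ b)         = C.bends-sym _ _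
    bends-sym (inj₁ a)         (inj₂ (inj₁ i))  = C.bends-sym _ _
    bends-sym (inj₁ a)         (inj₂ (inj₂ w))  = refl
    bends-sym (inj₂ (inj₁ i))  (inj₁ b)         = C.bends-sym _ _
    bends-sym (inj₂ (inj₂ w))  (inj₁ b)         = refl

    CollarEdge : Vertex → Vertex → Set
    CollarEdge s t = ∃₂ λ a b → s ≡ collarVertex a × t ≡ collarVertex b × adjC a b ≡ true × curve s t ≡ C.curve a b

    data EdgeKind : Vertex → Vertex → Set where
      old-edge    : ∀ o o′ → adjF (old o) (old o′) ≡ true → EdgeKind (inj₂ o) (inj₂ o′)
      collar-edge : ∀ {s t} → CollarEdge s t → EdgeKind s t

    private
      curve-≡ : ∀ s t a b → pos s ≡ C.pos a → bends s t ≡ C.bends a b → pos t ≡ C.pos b → curve s t ≡ C.curve a b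
      curve-≡ _ _ _ _ ps bs pt = cong₂ _∷_ ps (cong₂ _++_ bs (cong [_] pt))

    edgeKind : ∀ s t → adj s t ≡ true → EdgeKind s t
    edgeKind (inj₂ o)         (inj₂ o′)        st = old-edge o o′ st
    edgeKind (inj₁ a)         (inj₁ b)         st =
      collar-edge (_ , _ , sym (collarVertex-new a) , sym (collarVertex-new b) , st , refl)
    edgeKind (inj₁ a)         (inj₂ (inj₁ i))  st =
      collar-edge (_ , _ , sym (collarVertex-new a) , sym (collarVertex-corner i) , st ,
                   curve-≡ (inj₁ a) (inj₂ (inj₁ i)) (a ↑ˡ 3) (g ↑ʳ i) refl refl (pos-corner i))
    edgeKind (inj₂ (inj₁ i))  (inj₁ b)         st =
      collar-edge (_ , _ , sym (collarVertex-corner i) , sym (collarVertex-new b) , st ,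
                   curve-≡ (inj₂ (inj₁ i)) (inj₁ b) (g ↑ʳ i) (b ↑ˡ 3) (pos-corner i) refl refl)

    old-curve : ∀ o o′ → curve (inj₂ o) (inj₂ o′) ≡ map shrink (F.curve (old o) (old o′))
    old-curve o o′ =
      cong (shrink (F.pos (old o)) ∷_) (sym (map-++ shrink (F.bends (old o) (old o′)) [ F.pos (old o′) ]))

    old-edge-grown : ∀ o o′ → adjF (old o) (old o′) ≡ true → ∀ p → OnPath p (curve (inj₂ o) (inj₂ o′)) →
                     OnPath (grow p) (F.curve (old o) (old o′))
    old-edge-grown o o′ _ p on = grow-onPath (F.curve (old o) (old o′)) (subst (OnPath p) (old-curve o o′) on)

    old-edge-inner : ∀ o o′ → adjF (old o) (old o′) ≡ true → ∀ p → OnPath p (curve (inj₂ o) (inj₂ o′)) → Inner p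
    old-edge-inner o o′ oo′ p on =
      subst Inner (shrink-grow p) (shrink-inside (F.edges-inside _ _ oo′ (grow p) (old-edge-grown o o′ oo′ p on)))

    collar-edge-exits : ∀ {s t} → CollarEdge s t → ∀ p → OnPath p (curve s t) → Inner p → p ≡ pos s ⊎ p ≡ pos t
    collar-edge-exits (a , b , refl , refl , ab , curve≡) p on p∈ =
      map⊎ (λ p≡ → trans p≡ (sym (pos-collarVertex a))) (λ p≡ → trans p≡ (sym (pos-collarVertex b)))
           (C.edges-exit-inner a b ab p (subst (OnPath p) curve≡ on) p∈)

    private
      collar-avoid : ∀ {s t z} → CollarEdge s t → ∀ c → collarVertex c ≡ z → OnPath (C.pos c) (curve s t) →
                     z ≡ s ⊎ z ≡ t
      collar-avoid (a , b , refl , refl , ab , curve≡) c refl on =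
        map⊎ (cong collarVertex) (cong collarVertex) (C.avoid-verts a b c ab (subst (OnPath (C.pos c)) curve≡ on))

    avoid-verts : ∀ s t z → adj s t ≡ true → OnPath (pos z) (curve s t) → z ≡ s ⊎ z ≡ t
    avoid-verts s t z st on with edgeKind s t st
    avoid-verts _ _ (inj₁ c) _ on | old-edge o o′ oo′ =
      ⊥-elim (C.new-outside c (old-edge-inner o o′ oo′ _ on))
    avoid-verts _ _ (inj₂ o″) _ on | old-edge o o′ oo′ =
      map⊎ (cong inj₂ ∘ old-injective) (cong inj₂ ∘ old-injective)
           (F.avoid-verts _ _ (old o″) oo′ (subst (λ p → OnPath p (F.curve (old o) (old o′))) (grow-shrink _)
                                                  (old-edge-grown o o′ oo′ _ on)))
    avoid-verts s t (inj₂ (inj₂ w)) _ on | collar-edge st =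
      map⊎ (pos-injective _ _) (pos-injective _ _) (collar-edge-exits st _ on (old-inner (inj₂ w)))
    avoid-verts s t (inj₁ c) _ on | collar-edge st =
      collar-avoid st (c ↑ˡ 3) (collarVertex-new c) on
    avoid-verts s t (inj₂ (inj₁ i)) _ on | collar-edge st =
      collar-avoid st (g ↑ʳ i) (collarVertex-corner i) (subst (λ p → OnPath p (curve s t)) (pos-corner i) on)

    Interior : Point → Set
    Interior p = ∀ z → ¬ p ≡ pos z

    private
      old-partner : ∀ o o′ {x y p} → adjF (old o) (old o′) ≡ true → OnPath p (curve (inj₂ o) (inj₂ o′)) →
                    Interior p → EdgeKind x y → OnPath p (curve x y) →
                    ∃₂ λ ox oy → x ≡ inj₂ ox × y ≡ inj₂ oy × adjF (old ox) (old oy) ≡ true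
      old-partner _ _ _ _ _ (old-edge ox oy k) _ = ox , oy , refl , refl , k
      old-partner o o′ {x} {y} {p} oo′ on int (collar-edge xy) on-xy =
        ⊥-elim ([ int x , int y ]′ (collar-edge-exits xy p on-xy (old-edge-inner o o′ oo′ p on)))

      collar-partner : ∀ {s t x y p} → CollarEdge s t → OnPath p (curve s t) → Interior p →
                       EdgeKind x y → OnPath p (curve x y) → CollarEdge x y
      collar-partner _ _ _ (collar-edge xy) _ = xy
      collar-partner {s} {t} {p = p} st on int (old-edge ox oy k) on-xy =
        ⊥-elim ([ int s , int t ]′ (collar-edge-exits st p on (old-edge-inner ox oy k p on-xy)))

      grown-interior : ∀ o o′ p → adjF (old o) (old o′) ≡ true → OnPath p (curve (inj₂ o) (inj₂ o′)) → Interior p →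
                       OnePlanarDrawing.Interior F.drawing (grow p) (old o) (old o′)
      grown-interior o o′ p oo′ on int = old-edge-grown o o′ oo′ p on , λ w grown≡ →
        int (inj₂ (splitAt 3 w)) (trans (sym (shrink-grow p))
                                        (cong shrink (trans grown≡ (cong F.pos (sym (join-splitAt 3 m w))))))

      collar-interior : ∀ {a b s t p} → s ≡ collarVertex a → t ≡ collarVertex b → curve s t ≡ C.curve a b →
                        OnPath p (curve s t) → Interior p → OnePlanarDrawing.Interior C.drawing p a b
      collar-interior {p = p} refl refl curve≡ on int =
        subst (OnPath p) curve≡ on , λ c p≡ → int (collarVertex c) (trans p≡ (sym (pos-collarVertex c)))

      from-old : ∀ {a b c d} → Unordered (old a) (old b) (old c) (old d) →
                 Unordered (inj₂ a) (inj₂ b) (inj₂ c) (inj₂ d)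
      from-old = unordered-map (inj₂ {A = Fin g}) ∘ unordered-unmap old-injective

    one-crossing : ∀ s t x y x′ y′ p q → adj s t ≡ true → adj x y ≡ true → adj x′ y′ ≡ true →
      ¬ Unordered s t x y → ¬ Unordered s t x′ y′ →
      OnPath p (curve s t) × Interior p → OnPath p (curve x y) →
      OnPath q (curve s t) × Interior q → OnPath q (curve x′ y′) →
      p ≡ q × Unordered x y x′ y′
    one-crossing s t x y x′ y′ p q st xy x′y′ st≁xy st≁x′y′ (on-st , p-int) on-xy (on-st′ , q-int) on-x′y′
      with edgeKind s t st
    ... | old-edge o o′ oo′
      with old-partner o o′ oo′ on-st p-int (edgeKind x y xy) on-xy
         | old-partner o o′ oo′ on-st′ q-int (edgeKind x′ y′ x′y′) on-x′y′
    ... | ox , oy , refl , refl , kxy | ox′ , oy′ , refl , refl , kx′y′ =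
      let grown-p≡q , xy~x′y′ =
            F.one-crossing (old o) (old o′) (old ox) (old oy) (old ox′) (old oy′) (grow p) (grow q) oo′ kxy kx′y′
              (st≁xy ∘ from-old) (st≁x′y′ ∘ from-old)
              (grown-interior o o′ p oo′ on-st p-int) (old-edge-grown ox oy kxy p on-xy)
              (grown-interior o o′ q oo′ on-st′ q-int) (old-edge-grown ox′ oy′ kx′y′ q on-x′y′)
      in grow-injective grown-p≡q , from-old xy~x′y′
    one-crossing s t x y x′ y′ p q st xy x′y′ st≁xy st≁x′y′ (on-st , p-int) on-xy (on-st′ , q-int) on-x′y′
      | collar-edge st′@(a , b , s≡ , t≡ , ab , curve≡)
      with collar-partner st′ on-st p-int (edgeKind x y xy) on-xy
         | collar-partner st′ on-st′ q-int (edgeKind x′ y′ x′y′) on-x′y′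
    ... | a₁ , b₁ , x≡ , y≡ , a₁b₁ , curve₁≡ | a₂ , b₂ , x′≡ , y′≡ , a₂b₂ , curve₂≡ =
      let p≡q , a₁b₁~a₂b₂ =
            C.one-crossing a b a₁ b₁ a₂ b₂ p q ab a₁b₁ a₂b₂
              (st≁xy ∘ to-collar s≡ t≡ x≡ y≡) (st≁x′y′ ∘ to-collar s≡ t≡ x′≡ y′≡)
              (collar-interior s≡ t≡ curve≡ on-st p-int) (subst (OnPath p) curve₁≡ on-xy)
              (collar-interior s≡ t≡ curve≡ on-st′ q-int) (subst (OnPath q) curve₂≡ on-x′y′)
      in p≡q , to-collar x≡ y≡ x′≡ y′≡ a₁b₁~a₂b₂
      where
      to-collar : ∀ {s t x y a b c d} → s ≡ collarVertex a → t ≡ collarVertex b → x ≡ collarVertex c → y ≡ collarVertex d →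
                  Unordered a b c d → Unordered s t x y
      to-collar refl refl refl refl = unordered-map collarVertex

    toVertex : Fin (g + (3 + m)) → Vertex
    toVertex x = map⊎ id (splitAt 3) (splitAt g x)

    fromVertex : Vertex → Fin (g + (3 + m))
    fromVertex (inj₁ a) = a ↑ˡ (3 + m)
    fromVertex (inj₂ o) = g ↑ʳ old o

    toVertex-fromVertex : ∀ s → toVertex (fromVertex s) ≡ s
    toVertex-fromVertex (inj₁ a) = cong (map⊎ id (splitAt 3)) (splitAt-↑ˡ g a (3 + m))
    toVertex-fromVertex (inj₂ o) =
      trans (cong (map⊎ id (splitAt 3)) (splitAt-↑ʳ g (3 + m) (old o))) (cong inj₂ (splitAt-join 3 m o))

    fromVertex-toVertex : ∀ x → fromVertex (toVertex x) ≡ x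
    fromVertex-toVertex x with splitAt g x in eq
    ... | inj₁ a = splitAt⁻¹-↑ˡ eq
    ... | inj₂ w = trans (cong (g ↑ʳ_) (join-splitAt 3 m w)) (splitAt⁻¹-↑ʳ eq)

    toVertex-injective : ∀ {x y} → toVertex x ≡ toVertex y → x ≡ y
    toVertex-injective {x} {y} eq = trans (sym (fromVertex-toVertex x)) (trans (cong fromVertex eq) (fromVertex-toVertex y))

    graph : SimpleGraph (g + (3 + m))
    graph = record
      { Adj    = λ x y → adj (toVertex x) (toVertex y)
      ; sym    = λ x y → adj-sym (toVertex x) (toVertex y)
      ; irrefl = λ x → adj-irrefl (toVertex x)
      }

    drawing : OnePlanarDrawing graph
    drawing = record
      { pos          = pos ∘ toVertex
      ; bends        = λ x y → bends (toVertex x) (toVertex y)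
      ; pos-inj      = λ x y eq → toVertex-injective (pos-injective _ _ eq)
      ; bends-sym    = λ x y → bends-sym (toVertex x) (toVertex y)
      ; avoid-verts  = λ x y z xy on → map⊎ toVertex-injective toVertex-injective (avoid-verts _ _ (toVertex z) xy on)
      ; one-crossing = λ x y u v u′ v′ p q xy uv u′v′ xy≁uv xy≁u′v′ (on-xy , p-int) on-uv (on-xy′ , q-int) on-u′v′ →
          let p≡q , uv~u′v′ = one-crossing _ _ _ _ _ _ p q xy uv u′v′
                                (xy≁uv ∘ unordered-unmap toVertex-injective) (xy≁u′v′ ∘ unordered-unmap toVertex-injective)
                                (on-xy , interior p-int) on-uv (on-xy′ , interior q-int) on-u′v′
          in p≡q , unordered-unmap toVertex-injective uv~u′v′
      }
      where
      interior : ∀ {p} → (∀ x → ¬ p ≡ pos (toVertex x)) → Interior p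
      interior {p} int s p≡ = int (fromVertex s) (trans p≡ (cong pos (sym (toVertex-fromVertex s))))

    vertices-inside : ∀ s → Outer (pos s)
    vertices-inside (inj₁ a) = C.vertices-inside (a ↑ˡ 3)
    vertices-inside (inj₂ o) = inner⊆outer (old-inner o)

    edges-inside : ∀ s t → adj s t ≡ true → ∀ p → OnPath p (curve s t) → Outer p
    edges-inside s t st p on with edgeKind s t st
    ... | old-edge o o′ oo′ = inner⊆outer (old-edge-inner o o′ oo′ p on)
    ... | collar-edge (a , b , _ , _ , ab , curve≡) = C.edges-inside a b ab p (subst (OnPath p) curve≡ on)

  KeepsCorners : ∀ {k} → Collar (3 + k) → Set
  KeepsCorners {k} C = ∀ i → Collar.pos C ((i ↑ˡ k) ↑ˡ 3) ≡ corner i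

  nest : ∀ {k m} (C : Collar (3 + k)) → KeepsCorners C → Framed m → Framed (k + (3 + m))
  nest {k} {m} C keeps F = record
    { graph           = N.graph
    ; drawing         = N.drawing
    ; corners-at      = corners-at
    ; vertices-inside = N.vertices-inside ∘ N.toVertex
    ; edges-inside    = λ x y → N.edges-inside (N.toVertex x) (N.toVertex y)
    }
    where
    module N = Nest C F
    corners-at : ∀ i → N.pos (N.toVertex (i ↑ˡ (k + (3 + m)))) ≡ corner i
    corners-at zero             = keeps zero
    corners-at (suc zero)       = keeps (suc zero)
    corners-at (suc (suc zero)) = keeps (suc (suc zero))

module Counting where

  open import Data.Bool using (Bool; true; false; if_then_else_)
  open import Data.Fin using (Fin; zero; suc; _↑ˡ_; _↑ʳ_)
  open import Data.Fin.Subset using (Subset; ∣_∣)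
  open import Data.List using (map; allFin; tabulate; _∷_; _++_)
  open import Data.List.Properties using (map-tabulate; map-cong)
  open import Data.Nat using (ℕ; zero; suc; _+_)
  open import Data.Nat.ListAction using (sum)
  open import Data.Nat.ListAction.Properties using (sum-++)
  open import Data.Vec using ([]) renaming (_∷_ to _∷ᵥ_; _++_ to _++ᵥ_)
  open import Function using (_∘_)
  open import Relation.Binary.PropositionalEquality

  private
    ind : Bool → ℕ
    ind b = if b then 1 else 0

  count : ∀ {n} → (Fin n → Bool) → ℕ
  count {n} f = sum (map (ind ∘ f) (allFin n))

  count-cong : ∀ {n} {f f′ : Fin n → Bool} → (∀ v → f v ≡ f′ v) → count f ≡ count f′
  count-cong {n} f≗f′ = cong sum (map-cong (cong ind ∘ f≗f′) (allFin n))

  private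
    tabulate-++ : ∀ {A : Set} g {M} (f : Fin (g + M) → A) →
                  tabulate f ≡ tabulate (f ∘ (_↑ˡ M)) ++ tabulate (f ∘ (g ↑ʳ_))
    tabulate-++ zero    f = refl
    tabulate-++ (suc g) f = cong (f zero ∷_) (tabulate-++ g (f ∘ suc))

    count-tabulate : ∀ {n} (f : Fin n → Bool) → count f ≡ sum (tabulate (ind ∘ f))
    count-tabulate f = cong sum (map-tabulate (λ v → v) (ind ∘ f))

  count-++ : ∀ g {M} (f : Fin (g + M) → Bool) → count f ≡ count (f ∘ (_↑ˡ M)) + count (f ∘ (g ↑ʳ_))
  count-++ g {M} f = begin
    count f                          ≡⟨ count-tabulate f ⟩
    sum (tabulate (ind ∘ f))         ≡⟨ cong sum (tabulate-++ g (ind ∘ f)) ⟩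
    sum (left ++ right)              ≡⟨ sum-++ left right ⟩
    sum left + sum right             ≡⟨ cong₂ _+_ (count-tabulate (f ∘ (_↑ˡ M))) (count-tabulate (f ∘ (g ↑ʳ_))) ⟨
    count (f ∘ (_↑ˡ M)) + count (f ∘ (g ↑ʳ_)) ∎
    where
    open ≡-Reasoning
    left  = tabulate (ind ∘ f ∘ (_↑ˡ M))
    right = tabulate (ind ∘ f ∘ (g ↑ʳ_))

  count-false : ∀ {n} {f : Fin n → Bool} → (∀ v → f v ≡ false) → count f ≡ 0
  count-false {zero}  f≡false = refl
  count-false {suc n} {f} f≡false =
    trans (count-++ 1 f) (cong₂ _+_ (cong (λ b → ind b + 0) (f≡false zero)) (count-false (f≡false ∘ suc)))

  ∣++∣ : ∀ {a b} (p : Subset a) (q : Subset b) → ∣ p ++ᵥ q ∣ ≡ ∣ p ∣ + ∣ q ∣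
  ∣++∣ []           q = refl
  ∣++∣ (true ∷ᵥ p)  q = cong suc (∣++∣ p q)
  ∣++∣ (false ∷ᵥ p) q = ∣++∣ p q

module MarkedNesting where

  open import Defs hiding (sym)
  open Nesting
  open Counting
  open import Data.Bool using (Bool; true; false)
  open import Data.Fin using (zero; suc; _↑ˡ_; _↑ʳ_; splitAt)
  open import Data.Fin.Properties using (splitAt-↑ˡ; splitAt-↑ʳ; join-splitAt)
  open import Data.Fin.Subset using (Subset; ∣_∣)
  open import Data.Nat using (ℕ; zero; suc; _+_; _*_; _≤_; z≤n; s≤s)
  open import Data.Nat.Solver using (module +-*-Solver)
  open +-*-Solver using (solve; _:+_; _:*_; _:=_; con)
  open import Data.Nat.Properties using (≤-trans; m≤n+m; +-identityʳ; +-assoc; module ≤-Reasoning)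
  open import Data.Product using (_,_)
  open import Data.Sum using (inj₁; inj₂)
  open import Data.Vec using (lookup) renaming (_++_ to _++ᵥ_)
  open import Data.Vec.Properties using (lookup-++ˡ; lookup-++ʳ; []=⇒lookup)
  open import Function using (_∘_)
  open import Relation.Binary.PropositionalEquality

  record FramedSet (d c : ℕ) {m : ℕ} (F : Framed m) : Set where
    field
      I            : Subset (3 + m)
      independent  : ∀ u v → lookup I u ≡ true → lookup I v ≡ true → Adj (Framed.graph F) u v ≡ false
      high-degree  : ∀ v → lookup I v ≡ true → d ≤ degree (Framed.graph F) v
      corners-free : ∀ i → lookup I (i ↑ˡ m) ≡ false
      size         : ∣ I ∣ ≡ c

  record CollarSet (d c : ℕ) {g : ℕ} (C : Collar g) : Set where
    field
      I           : Subset g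
      independent : ∀ a b → lookup I a ≡ true → lookup I b ≡ true → Adj (Collar.graph C) (a ↑ˡ 3) (b ↑ˡ 3) ≡ false
      high-degree : ∀ a → lookup I a ≡ true → d ≤ degree (Collar.graph C) (a ↑ˡ 3)
      size        : ∣ I ∣ ≡ c

  isDIndependent : ∀ {n d} (G : SimpleGraph n) (I : Subset n) →
                   (∀ u v → lookup I u ≡ true → lookup I v ≡ true → Adj G u v ≡ false) →
                   (∀ v → lookup I v ≡ true → d ≤ degree G v) → IsDIndependent d G I
  isDIndependent G I independent high-degree =
    (λ u v u∈ v∈ → independent u v ([]=⇒lookup u∈) ([]=⇒lookup v∈)) ,
    (λ v v∈ → high-degree v ([]=⇒lookup v∈))

  module NestSet {g m d c c′ : ℕ} {C : Collar g} {F : Framed m}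
                 (S : CollarSet d c′ C) (T : FramedSet d c F) where

    open Nest C F public
    private
      module C = Collar C
      module F = Framed F
      module S = CollarSet S
      module T = FramedSet T

    I : Subset (g + (3 + m))
    I = S.I ++ᵥ T.I

    marked : Vertex → Bool
    marked (inj₁ a) = lookup S.I a
    marked (inj₂ o) = lookup T.I (old o)

    lookup-I : ∀ x → lookup I x ≡ marked (toVertex x)
    lookup-I x = trans (cong (lookup I) (sym (fromVertex-toVertex x))) (lookup-fromVertex (toVertex x))
      where
      lookup-fromVertex : ∀ s → lookup I (fromVertex s) ≡ marked s
      lookup-fromVertex (inj₁ a) = lookup-++ˡ S.I T.I a
      lookup-fromVertex (inj₂ o) = lookup-++ʳ S.I T.I (old o)

    private
      true≢false : ∀ {b} → b ≡ true → b ≡ false → ∀ {A : Set} → A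
      true≢false refl ()

    marked-independent : ∀ s t → marked s ≡ true → marked t ≡ true → adj s t ≡ false
    marked-independent (inj₂ o)         (inj₂ o′)        s∈ t∈ = T.independent _ _ s∈ t∈
    marked-independent (inj₁ a)         (inj₁ b)         s∈ t∈ = S.independent a b s∈ t∈
    marked-independent (inj₁ a)         (inj₂ (inj₁ i))  s∈ t∈ = true≢false t∈ (T.corners-free i)
    marked-independent (inj₁ a)         (inj₂ (inj₂ w))  s∈ t∈ = refl
    marked-independent (inj₂ (inj₁ i))  (inj₁ b)         s∈ t∈ = true≢false s∈ (T.corners-free i)
    marked-independent (inj₂ (inj₂ w))  (inj₁ b)         s∈ t∈ = refl

    private
      toVertex-old : ∀ w → toVertex (g ↑ʳ w) ≡ inj₂ (splitAt 3 w)
      toVertex-old w = cong (Data.Sum.map (λ a → a) (splitAt 3)) (splitAt-↑ʳ g (3 + m) w)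
        where import Data.Sum

    degree-split : ∀ s → degree graph (fromVertex s) ≡
                         count (λ b → adj s (inj₁ b)) + count (λ w → adj s (inj₂ (splitAt 3 w)))
    degree-split s = begin
      degree graph (fromVertex s)
        ≡⟨ count-cong (λ y → cong (λ s → adj s (toVertex y)) (toVertex-fromVertex s)) ⟩
      count (λ y → adj s (toVertex y))
        ≡⟨ count-++ g (λ y → adj s (toVertex y)) ⟩
      count (λ b → adj s (toVertex (b ↑ˡ (3 + m)))) + count (λ w → adj s (toVertex (g ↑ʳ w)))
        ≡⟨ cong₂ _+_ (count-cong (λ b → cong (adj s) (toVertex-fromVertex (inj₁ b))))
                     (count-cong (λ w → cong (adj s) (toVertex-old w))) ⟩
      count (λ b → adj s (inj₁ b)) + count (λ w → adj s (inj₂ (splitAt 3 w)))  ∎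
      where open ≡-Reasoning

    degree-new : ∀ a → degree graph (fromVertex (inj₁ a)) ≡ degree C.graph (a ↑ˡ 3)
    degree-new a = begin
      degree graph (fromVertex (inj₁ a))
        ≡⟨ degree-split (inj₁ a) ⟩
      count (λ b → adj (inj₁ a) (inj₁ b)) + count (λ w → adj (inj₁ a) (inj₂ (splitAt 3 w)))
        ≡⟨ cong (count (λ b → adj (inj₁ a) (inj₁ b)) +_) (count-++ 3 (λ w → adj (inj₁ a) (inj₂ (splitAt 3 w)))) ⟩
      count (λ b → adj (inj₁ a) (inj₁ b)) +
        (count (λ i → adj (inj₁ a) (inj₂ (splitAt 3 (i ↑ˡ m)))) + count (λ w → adj (inj₁ a) (inj₂ (splitAt 3 (3 ↑ʳ w)))))
        ≡⟨ cong (count (λ b → adj (inj₁ a) (inj₁ b)) +_) (cong₂ _+_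
             (count-cong (λ i → cong (adj (inj₁ a) ∘ inj₂) (splitAt-↑ˡ 3 i m)))
             (count-false (λ w → cong (adj (inj₁ a) ∘ inj₂) (splitAt-↑ʳ 3 m w)))) ⟩
      count (λ b → Adj C.graph (a ↑ˡ 3) (b ↑ˡ 3)) + (count (λ i → Adj C.graph (a ↑ˡ 3) (g ↑ʳ i)) + 0)
        ≡⟨ cong (count (λ b → Adj C.graph (a ↑ˡ 3) (b ↑ˡ 3)) +_) (+-identityʳ _) ⟩
      count (λ b → Adj C.graph (a ↑ˡ 3) (b ↑ˡ 3)) + count (λ i → Adj C.graph (a ↑ˡ 3) (g ↑ʳ i))
        ≡⟨ count-++ g (Adj C.graph (a ↑ˡ 3)) ⟨
      degree C.graph (a ↑ˡ 3)  ∎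
      where open ≡-Reasoning

    degree-old : ∀ o → degree F.graph (old o) ≤ degree graph (fromVertex (inj₂ o))
    degree-old o = begin
      degree F.graph (old o)
        ≡⟨ count-cong (λ w → cong (Adj F.graph (old o)) (join-splitAt 3 m w)) ⟨
      count (λ w → adj (inj₂ o) (inj₂ (splitAt 3 w)))
        ≤⟨ m≤n+m _ (count (λ b → adj (inj₂ o) (inj₁ b))) ⟩
      count (λ b → adj (inj₂ o) (inj₁ b)) + count (λ w → adj (inj₂ o) (inj₂ (splitAt 3 w)))
        ≡⟨ degree-split (inj₂ o) ⟨
      degree graph (fromVertex (inj₂ o))  ∎
      where open ≤-Reasoning

    marked-high-degree : ∀ s → marked s ≡ true → d ≤ degree graph (fromVertex s)
    marked-high-degree (inj₁ a) a∈ = subst (d ≤_) (sym (degree-new a)) (S.high-degree a a∈)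
    marked-high-degree (inj₂ o) o∈ = ≤-trans (T.high-degree (old o) o∈) (degree-old o)

    size : ∣ I ∣ ≡ c′ + c
    size = trans (∣++∣ S.I T.I) (cong₂ _+_ S.size T.size)

    independent : ∀ x y → lookup I x ≡ true → lookup I y ≡ true → Adj graph x y ≡ false
    independent x y x∈ y∈ =
      marked-independent (toVertex x) (toVertex y) (trans (sym (lookup-I x)) x∈) (trans (sym (lookup-I y)) y∈)

    high-degree : ∀ x → lookup I x ≡ true → d ≤ degree graph x
    high-degree x x∈ = subst (λ x → d ≤ degree graph x) (fromVertex-toVertex x)
                             (marked-high-degree (toVertex x) (trans (sym (lookup-I x)) x∈))

  record Marked (d : ℕ) : Set where
    field
      m c    : ℕ
      framed : Framed m
      set    : FramedSet d c framed

  record Layer (d k c : ℕ) : Set where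
    field
      collar           : Collar (3 + k)
      keeps-corners    : KeepsCorners collar
      set              : CollarSet d c collar
      corners-unmarked : ∀ i → lookup (CollarSet.I set) (i ↑ˡ k) ≡ false

  wrap : ∀ {d k c′} → Layer d k c′ → Marked d → Marked d
  wrap {d} {k} {c′} L M = record
    { m      = k + (3 + M.m)
    ; c      = c′ + M.c
    ; framed = nest L.collar L.keeps-corners M.framed
    ; set    = record
      { I            = N.I
      ; independent  = N.independent
      ; high-degree  = N.high-degree
      ; corners-free = corners-free
      ; size         = N.size
      }
    }
    where
    module L = Layer L
    module M = Marked M
    module N = NestSet L.set M.set
    marked-corner : ∀ i → lookup N.I ((i ↑ˡ k) ↑ˡ (3 + M.m)) ≡ false
    marked-corner i = trans (lookup-++ˡ (CollarSet.I L.set) (FramedSet.I M.set) (i ↑ˡ k)) (L.corners-unmarked i)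
    corners-free : ∀ i → lookup N.I (i ↑ˡ (k + (3 + M.m))) ≡ false
    corners-free zero             = marked-corner zero
    corners-free (suc zero)       = marked-corner (suc zero)
    corners-free (suc (suc zero)) = marked-corner (suc (suc zero))

  iterate : ∀ {d k c′} → Layer d k c′ → Marked d → ℕ → Marked d
  iterate L M zero    = M
  iterate L M (suc j) = wrap L (iterate L M j)

  iterate-m : ∀ {d k c′} (L : Layer d k c′) M j → Marked.m (iterate L M j) ≡ j * (3 + k) + Marked.m M
  iterate-m             L M zero    = refl
  iterate-m {k = k} L M (suc j) = trans (cong (λ m → k + (3 + m)) (iterate-m L M j)) (step j k (Marked.m M))
    where
    step : ∀ j k m → k + (3 + (j * (3 + k) + m)) ≡ suc j * (3 + k) + m
    step = solve 3 (λ j k m → k :+ (con 3 :+ (j :* (con 3 :+ k) :+ m)) := (con 1 :+ j) :* (con 3 :+ k) :+ m) refl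

  iterate-c : ∀ {d k c′} (L : Layer d k c′) M j → Marked.c (iterate L M j) ≡ j * c′ + Marked.c M
  iterate-c              L M zero    = refl
  iterate-c {c′ = c′} L M (suc j) = trans (cong (c′ +_) (iterate-c L M j)) (sym (+-assoc c′ (j * c′) (Marked.c M)))

  iterate-grows : ∀ {d k c′} (L : Layer d k c′) M j → j ≤ Marked.m (iterate L M j)
  iterate-grows             L M zero    = z≤n
  iterate-grows {k = k} L M (suc j) =
    ≤-trans (s≤s (iterate-grows L M j)) (≤-trans (m≤n+m (suc m) 2) (m≤n+m (3 + m) k))
    where m = Marked.m (iterate L M j)

module Building where

  open import Defs hiding (sym)
  open CertifiedDrawing
  open Triangles
  open Nesting
  open MarkedNesting
  open Literals
  open import Agda.Builtin.FromNat using (fromNat)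
  open import Data.Unit using (tt)
  open import Data.Bool as Bool using (Bool; true; false)
  open import Data.Fin as Fin using (Fin; _↑ˡ_; _↑ʳ_)
  open import Data.Fin.Properties using (all?)
  open import Data.Fin.Subset using (Subset; ∣_∣)
  open import Data.List using (List; []; _∷_)
  open import Data.Nat using (ℕ; _+_; _≤_; _≤?_)
  open import Data.Product using (_×_; _,_; proj₁; proj₂)
  open import Data.Product.Properties using (≡-dec)
  open import Data.Vec using (Vec; lookup)
  open import Relation.Binary.PropositionalEquality
  open import Relation.Nullary using (Dec; yes; no; ¬_; ¬?; _×-dec_; _→-dec_)
  open import Relation.Nullary.Decidable using (True; toWitness)

  bendTable : ∀ {N} → List ((Fin N × Fin N) × List Point) → Fin N → Fin N → List Point
  bendTable []                  u v = []
  bendTable ((e , bends) ∷ table) u v with ≡-dec Fin._≟_ Fin._≟_ e (u , v)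
  ... | yes _ = bends
  ... | no _  = bendTable table u v

  module Tables {N : ℕ} (E : List (Fin N × Fin N)) (P : Vec Point N)
                (B : List ((Fin N × Fin N) × List Point)) where

    open Certificate E (lookup P) (bendTable B) public

    DrawnInT : Set
    DrawnInT = Planar1 × (∀ v → InTriangle 2048 (lookup P v)) × CurvesInside 2048

    drawnInT? : Dec DrawnInT
    drawnInT? = planar1? ×-dec all? (λ v → inTriangle? 2048 (lookup P v)) ×-dec curvesInside? 2048

    module FromDrawnInT (certified : DrawnInT) where
      open Sound (proj₁ certified) public

      vertices-inside : ∀ v → Outer (lookup P v)
      vertices-inside v = subst (λ R → R (lookup P v)) (sym Outer-literal) (proj₁ (proj₂ certified) v)

      edges-inside : ∀ u v → Adj graph u v ≡ true → ∀ p → OnPath p (curve u v) → Outer p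
      edges-inside u v uv p on =
        subst (λ R → R p) (sym Outer-literal) (curve-inside (proj₂ (proj₂ certified)) u v uv p on)

  module _ {m : ℕ} (E : List (Fin (3 + m) × Fin (3 + m))) (P : Vec Point (3 + m))
           (B : List ((Fin (3 + m) × Fin (3 + m)) × List Point)) where

    open Tables E P B

    FramedCertificate : Set
    FramedCertificate = DrawnInT × (∀ i → lookup P (i ↑ˡ m) ≡ corner i)

    framedCertificate? : Dec FramedCertificate
    framedCertificate? = drawnInT? ×-dec all? (λ i → lookup P (i ↑ˡ m) ≟ₚ corner i)

    certifiedFramed : True framedCertificate? → Framed m
    certifiedFramed ok = record
      { graph           = graph
      ; drawing         = drawing
      ; corners-at      = proj₂ (toWitness ok)
      ; vertices-inside = vertices-inside
      ; edges-inside    = edges-inside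
      }
      where open FromDrawnInT (proj₁ (toWitness ok))

  module _ {g : ℕ} (E : List (Fin (g + 3) × Fin (g + 3))) (P : Vec Point (g + 3))
           (B : List ((Fin (g + 3) × Fin (g + 3)) × List Point)) where

    open Tables E P B

    CollarCertificate : Set
    CollarCertificate = DrawnInT × (∀ i → lookup P (g ↑ʳ i) ≡ innerCorner i)
                      × CurvesExit 512 × (∀ a → ¬ InTriangle 512 (lookup P (a ↑ˡ 3)))

    collarCertificate? : Dec CollarCertificate
    collarCertificate? = drawnInT? ×-dec all? (λ i → lookup P (g ↑ʳ i) ≟ₚ innerCorner i)
                       ×-dec curvesExit? 512 ×-dec all? (λ a → ¬? (inTriangle? 512 (lookup P (a ↑ˡ 3))))

    certifiedCollar : True collarCertificate? → Collar g
    certifiedCollar ok = record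
      { graph            = graph
      ; drawing          = drawing
      ; inner-corners-at = λ i → trans (inner-corners i) (sym (shrink-corner i))
      ; vertices-inside  = vertices-inside
      ; edges-inside     = edges-inside
      ; edges-exit-inner = λ u v uv p on p∈ → curve-exits exits u v uv p on (subst (λ R → R p) Inner-literal p∈)
      ; new-outside      = λ a a∈ → outside a (subst (λ R → R (lookup P (a ↑ˡ 3))) Inner-literal a∈)
      }
      where
      open FromDrawnInT (proj₁ (toWitness ok))
      inner-corners = proj₁ (proj₂ (toWitness ok))
      exits         = proj₁ (proj₂ (proj₂ (toWitness ok)))
      outside       = proj₂ (proj₂ (proj₂ (toWitness ok)))

  module _ {m : ℕ} (d : ℕ) (F : Framed m) (I : Subset (3 + m)) where

    private
      G = Framed.graph F

    FramedSetCertificate : Set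
    FramedSetCertificate = (∀ u v → lookup I u ≡ true → lookup I v ≡ true → Adj G u v ≡ false)
                         × (∀ v → lookup I v ≡ true → d ≤ degree G v) × (∀ i → lookup I (i ↑ˡ m) ≡ false)

    framedSetCertificate? : Dec FramedSetCertificate
    framedSetCertificate? =
      all? (λ u → all? λ v → lookup I u Bool.≟ true →-dec lookup I v Bool.≟ true →-dec Adj G u v Bool.≟ false)
      ×-dec all? (λ v → lookup I v Bool.≟ true →-dec d ≤? degree G v)
      ×-dec all? (λ i → lookup I (i ↑ˡ m) Bool.≟ false)

    certifiedFramedSet : True framedSetCertificate? → FramedSet d ∣ I ∣ F
    certifiedFramedSet ok = record
      { I            = I
      ; independent  = proj₁ (toWitness ok)
      ; high-degree  = proj₁ (proj₂ (toWitness ok))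
      ; corners-free = proj₂ (proj₂ (toWitness ok))
      ; size         = refl
      }

  module _ {g : ℕ} (d : ℕ) (C : Collar g) (I : Subset g) where

    private
      G = Collar.graph C

    CollarSetCertificate : Set
    CollarSetCertificate = (∀ a b → lookup I a ≡ true → lookup I b ≡ true → Adj G (a ↑ˡ 3) (b ↑ˡ 3) ≡ false)
                         × (∀ a → lookup I a ≡ true → d ≤ degree G (a ↑ˡ 3))

    collarSetCertificate? : Dec CollarSetCertificate
    collarSetCertificate? =
      all? (λ a → all? λ b → lookup I a Bool.≟ true →-dec lookup I b Bool.≟ true
                               →-dec Adj G (a ↑ˡ 3) (b ↑ˡ 3) Bool.≟ false)
      ×-dec all? (λ a → lookup I a Bool.≟ true →-dec d ≤? degree G (a ↑ˡ 3))

    certifiedCollarSet : True collarSetCertificate? → CollarSet d ∣ I ∣ C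
    certifiedCollarSet ok = record
      { I           = I
      ; independent = proj₁ (toWitness ok)
      ; high-degree = proj₂ (toWitness ok)
      ; size        = refl
      }

  module _ {k : ℕ} (d : ℕ) (C : Collar (3 + k)) (I : Subset (3 + k)) where

    LayerCertificate : Set
    LayerCertificate = KeepsCorners C × (∀ i → lookup I (i ↑ˡ k) ≡ false)

    layerCertificate? : Dec LayerCertificate
    layerCertificate? = all? (λ i → Collar.pos C ((i ↑ˡ k) ↑ˡ 3) ≟ₚ corner i)
                  ×-dec all? (λ i → lookup I (i ↑ˡ k) Bool.≟ false)

    certifiedLayer : True (collarSetCertificate? d C I) → True layerCertificate? → Layer d k ∣ I ∣
    certifiedLayer set-ok layer-ok = record
      { collar           = C
      ; keeps-corners    = proj₁ (toWitness layer-ok)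
      ; set              = certifiedCollarSet d C I set-ok
      ; corners-unmarked = proj₂ (toWitness layer-ok)
      }

module Gadgets where

  open import Defs using (Point)
  open Nesting using (Collar)
  open MarkedNesting using (CollarSet; Layer; Marked)
  open Building
  open Literals
  open import Agda.Builtin.FromNat using (fromNat)
  open import Agda.Builtin.FromNeg using (fromNeg)
  open import Data.Unit using (tt)
  open import Data.Fin using (Fin; #_)
  open import Data.Fin.Subset using (inside; outside)
  open import Data.List using (List; []; _∷_)
  open import Data.Product using (_×_; _,_)
  open import Data.Vec using (Vec; []; _∷_)

  triangle-positions : Vec Point 3
  triangle-positions =
    (0 , 1024) ∷ (-1024 , -512) ∷ (1024 , -512) ∷
    []

  triangle : Marked 6
  triangle = record
    { m = 0 ; c = 0 ; framed = framed
    ; set = certifiedFramedSet 6 framed (outside ∷ outside ∷ outside ∷ []) _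
    }
    where framed = certifiedFramed [] triangle-positions [] _

  base₃-positions : Vec Point 6
  base₃-positions =
    (0 , 1024) ∷ (-1024 , -512) ∷ (1024 , -512) ∷ (-358 , 179) ∷
    (0 , -358) ∷ (358 , 179) ∷
    []

  base₃-edges : List (Fin 6 × Fin 6)
  base₃-edges =
    (# 0 , # 3) ∷ (# 0 , # 4) ∷ (# 0 , # 5) ∷ (# 1 , # 3) ∷ (# 1 , # 4) ∷ (# 1 , # 5) ∷
    (# 2 , # 3) ∷ (# 2 , # 4) ∷ (# 2 , # 5) ∷
    []

  base₃-bends : List ((Fin 6 × Fin 6) × List Point)
  base₃-bends =
    ((# 0 , # 4) , (-799 , -358) ∷ []) ∷
    ((# 1 , # 5) , (758 , -420) ∷ []) ∷
    ((# 2 , # 3) , (41 , 778) ∷ []) ∷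
    []

  -- Three marked vertices inside T, each joined to the three corners.
  base₃ : Marked 3
  base₃ = record
    { m = 3 ; c = 3 ; framed = framed
    ; set = certifiedFramedSet 3 framed (outside ∷ outside ∷ outside ∷ inside ∷ inside ∷ inside ∷ []) _
    }
    where framed = certifiedFramed base₃-edges base₃-positions base₃-bends _

  layer₆-positions : Vec Point 9
  layer₆-positions =
    (0 , 1024) ∷ (-1024 , -512) ∷ (1024 , -512) ∷ (-320 , 160) ∷
    (0 , -320) ∷ (320 , 160) ∷ (0 , 256) ∷ (-256 , -128) ∷
    (256 , -128) ∷
    []

  layer₆-edges : List (Fin 9 × Fin 9)
  layer₆-edges =
    (# 0 , # 3) ∷ (# 0 , # 4) ∷ (# 0 , # 5) ∷ (# 1 , # 3) ∷ (# 1 , # 4) ∷ (# 1 , # 5) ∷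
    (# 2 , # 3) ∷ (# 2 , # 4) ∷ (# 2 , # 5) ∷ (# 3 , # 6) ∷ (# 3 , # 7) ∷ (# 3 , # 8) ∷
    (# 4 , # 6) ∷ (# 4 , # 7) ∷ (# 4 , # 8) ∷ (# 5 , # 6) ∷ (# 5 , # 7) ∷ (# 5 , # 8) ∷
    []

  layer₆-bends : List ((Fin 9 × Fin 9) × List Point)
  layer₆-bends =
    ((# 0 , # 4) , (-887 , -403) ∷ []) ∷
    ((# 1 , # 5) , (846 , -464) ∷ []) ∷
    ((# 2 , # 3) , (41 , 867) ∷ []) ∷
    ((# 3 , # 8) , (-332 , -176) ∷ []) ∷
    ((# 4 , # 6) , (342 , -161) ∷ []) ∷
    ((# 5 , # 7) , (-10 , 337) ∷ []) ∷
    []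

  -- Vertices 3, 4, 5 are marked and joined to all six corners of T and T/4.
  layer₆ : Layer 6 3 3
  layer₆ = certifiedLayer 6 (certifiedCollar layer₆-edges layer₆-positions layer₆-bends _)
                          (outside ∷ outside ∷ outside ∷ inside ∷ inside ∷ inside ∷ []) _ _

  layer₃-positions : Vec Point 24
  layer₃-positions =
    (0 , 1024) ∷ (-1024 , -512) ∷ (1024 , -512) ∷ (-461 , -128) ∷
    (-512 , -205) ∷ (-307 , -51) ∷ (-205 , 410) ∷ (-410 , 256) ∷
    (-410 , 102) ∷ (358 , -282) ∷ (461 , -282) ∷ (205 , -205) ∷
    (-307 , -358) ∷ (-51 , -435) ∷ (102 , -358) ∷ (102 , 410) ∷
    (51 , 486) ∷ (102 , 256) ∷ (512 , -51) ∷ (461 , 179) ∷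
    (307 , 256) ∷ (0 , 256) ∷ (-256 , -128) ∷ (256 , -128) ∷
    []

  layer₃-edges : List (Fin 24 × Fin 24)
  layer₃-edges =
    (# 0 , # 6) ∷ (# 0 , # 7) ∷ (# 0 , # 8) ∷ (# 0 , # 15) ∷ (# 0 , # 16) ∷ (# 0 , # 17) ∷
    (# 0 , # 18) ∷ (# 0 , # 19) ∷ (# 0 , # 20) ∷ (# 1 , # 3) ∷ (# 1 , # 4) ∷ (# 1 , # 5) ∷
    (# 1 , # 6) ∷ (# 1 , # 7) ∷ (# 1 , # 8) ∷ (# 1 , # 12) ∷ (# 1 , # 13) ∷ (# 1 , # 14) ∷
    (# 2 , # 9) ∷ (# 2 , # 10) ∷ (# 2 , # 11) ∷ (# 2 , # 12) ∷ (# 2 , # 13) ∷ (# 2 , # 14) ∷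
    (# 2 , # 18) ∷ (# 2 , # 19) ∷ (# 2 , # 20) ∷ (# 3 , # 21) ∷ (# 3 , # 22) ∷ (# 4 , # 21) ∷
    (# 4 , # 22) ∷ (# 5 , # 21) ∷ (# 5 , # 22) ∷ (# 6 , # 21) ∷ (# 7 , # 21) ∷ (# 8 , # 21) ∷
    (# 9 , # 22) ∷ (# 9 , # 23) ∷ (# 10 , # 22) ∷ (# 10 , # 23) ∷ (# 11 , # 22) ∷ (# 11 , # 23) ∷
    (# 12 , # 22) ∷ (# 13 , # 22) ∷ (# 14 , # 22) ∷ (# 15 , # 21) ∷ (# 15 , # 23) ∷ (# 16 , # 21) ∷
    (# 16 , # 23) ∷ (# 17 , # 21) ∷ (# 17 , # 23) ∷ (# 18 , # 23) ∷ (# 19 , # 23) ∷ (# 20 , # 23) ∷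
    []

  layer₃-bends : List ((Fin 24 × Fin 24) × List Point)
  layer₃-bends =
    ((# 0 , # 8) , (-799 , -266) ∷ (-666 , -128) ∷ []) ∷
    ((# 0 , # 17) , (31 , 287) ∷ (51 , 294) ∷ []) ∷
    ((# 0 , # 18) , (323 , -59) ∷ (371 , -32) ∷ []) ∷
    ((# 1 , # 5) , (-302 , -120) ∷ (-320 , -109) ∷ []) ∷
    ((# 1 , # 6) , (-102 , 271) ∷ (-154 , 295) ∷ []) ∷
    ((# 1 , # 14) , (666 , -466) ∷ (461 , -435) ∷ []) ∷
    ((# 2 , # 11) , (271 , -166) ∷ (269 , -186) ∷ []) ∷
    ((# 2 , # 12) , (-220 , -212) ∷ (-218 , -262) ∷ []) ∷
    ((# 2 , # 20) , (133 , 732) ∷ (205 , 563) ∷ []) ∷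
    ((# 3 , # 22) , (-243 , 45) ∷ (-148 , 125) ∷ []) ∷
    ((# 4 , # 21) , (-717 , -320) ∷ (-829 , -389) ∷ []) ∷
    ((# 7 , # 21) , (-205 , 602) ∷ (-123 , 763) ∷ []) ∷
    ((# 9 , # 23) , (77 , -205) ∷ (-51 , -174) ∷ []) ∷
    ((# 10 , # 22) , (678 , -378) ∷ (804 , -428) ∷ []) ∷
    ((# 13 , # 22) , (-499 , -454) ∷ (-701 , -474) ∷ []) ∷
    ((# 15 , # 21) , (166 , 160) ∷ (200 , 49) ∷ []) ∷
    ((# 16 , # 23) , (38 , 697) ∷ (26 , 817) ∷ []) ∷
    ((# 19 , # 23) , (704 , -147) ∷ (824 , -289) ∷ []) ∷
    []

  -- Vertices 3 to 20 are marked, each joined to three of the six corners of T and T/4.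
  layer₃ : Layer 3 18 18
  layer₃ = certifiedLayer 3 (certifiedCollar layer₃-edges layer₃-positions layer₃-bends _)
    (outside ∷ outside ∷ outside ∷ inside ∷ inside ∷ inside ∷ inside ∷ inside ∷ inside ∷ inside ∷ inside ∷
     inside ∷ inside ∷ inside ∷ inside ∷ inside ∷ inside ∷ inside ∷ inside ∷ inside ∷ inside ∷ []) _ _

  cap₃-positions : Vec Point 6
  cap₃-positions =
    (243 , 122) ∷ (0 , -243) ∷ (-243 , 122) ∷ (0 , 256) ∷
    (-256 , -128) ∷ (256 , -128) ∷
    []

  cap₃-edges : List (Fin 6 × Fin 6)
  cap₃-edges =
    (# 0 , # 3) ∷ (# 0 , # 4) ∷ (# 0 , # 5) ∷ (# 1 , # 3) ∷ (# 1 , # 4) ∷ (# 1 , # 5) ∷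
    (# 2 , # 3) ∷ (# 2 , # 4) ∷ (# 2 , # 5) ∷
    []

  cap₃-bends : List ((Fin 6 × Fin 6) × List Point)
  cap₃-bends =
    ((# 0 , # 4) , (0 , 294) ∷ (-51 , 256) ∷ []) ∷
    ((# 1 , # 3) , (294 , -147) ∷ (282 , -90) ∷ []) ∷
    ((# 2 , # 5) , (-294 , -147) ∷ (-230 , -166) ∷ []) ∷
    []

  -- Three marked vertices, each joined to the three corners of T/4.
  cap₃ : Collar 3
  cap₃ = certifiedCollar cap₃-edges cap₃-positions cap₃-bends _

  cap₃-set : CollarSet 3 3 cap₃
  cap₃-set = certifiedCollarSet 3 cap₃ (inside ∷ inside ∷ inside ∷ []) _


open import Defs
open Nesting
open MarkedNesting
open Gadgets
open import Data.Nat using (ℕ; _≤_; _*_; _∸_; _+_)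
open import Data.Nat.Properties using (≤-trans; m≤n+m)
open import Data.Nat.Solver using (module +-*-Solver)
open +-*-Solver using (solve; _:+_; _:*_; _:=_; con)
open import Data.Fin.Subset using (Subset; ∣_∣)
open import Data.Product using (Σ; _×_; _,_)
open import Relation.Binary.PropositionalEquality using (_≡_; refl; trans; cong; module ≡-Reasoning)

tower₆ : ℕ → Marked 6
tower₆ = iterate layer₆ triangle

tower₆-size : ∀ N → 2 * Marked.c (tower₆ N) ≡ Marked.m (tower₆ N)
tower₆-size N = begin
  2 * Marked.c (tower₆ N)  ≡⟨ cong (2 *_) (iterate-c layer₆ triangle N) ⟩
  2 * (N * 3 + 0)          ≡⟨ solve 1 (λ N → con 2 :* (N :* con 3 :+ con 0)
                                          := N :* (con 3 :+ con 3) :+ con 0) refl N ⟩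
  N * (3 + 3) + 0          ≡⟨ iterate-m layer₆ triangle N ⟨
  Marked.m (tower₆ N)      ∎
  where open ≡-Reasoning

tower₃ : ℕ → Marked 3
tower₃ = iterate layer₃ base₃

tower₃-size : ∀ N → 7 * (3 + Marked.c (tower₃ N)) ≡ 6 * (4 + Marked.m (tower₃ N))
tower₃-size N = begin
  7 * (3 + Marked.c (tower₃ N))  ≡⟨ cong (λ c → 7 * (3 + c)) (iterate-c layer₃ base₃ N) ⟩
  7 * (3 + (N * 18 + 3))         ≡⟨ solve 1 (λ N → con 7 :* (con 3 :+ (N :* con 18 :+ con 3))
                                               := con 6 :* (con 4 :+ (N :* (con 3 :+ con 18) :+ con 3))) refl N ⟩
  6 * (4 + (N * (3 + 18) + 3))   ≡⟨ cong (λ m → 6 * (4 + m)) (iterate-m layer₃ base₃ N) ⟨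
  6 * (4 + Marked.m (tower₃ N))  ∎
  where open ≡-Reasoning

lemma4p3 : (N : ℕ) →
    (Σ ℕ λ n → Σ (SimpleGraph n) λ S → N ≤ n × OnePlanar S ×
       (Σ (Subset n) λ I → IsDIndependent 3 S I × 7 * ∣ I ∣ ≡ 6 * (n ∸ 2)))
    ×
    (Σ ℕ λ n → Σ (SimpleGraph n) λ S → N ≤ n × OnePlanar S ×
       (Σ (Subset n) λ I → IsDIndependent 6 S I × 2 * ∣ I ∣ ≡ n ∸ 3))
lemma4p3 N =
  (3 + (3 + M₃.m) , C₃.graph , ≤-trans (iterate-grows layer₃ base₃ N) (m≤n+m _ 6) , C₃.drawing ,
   C₃.I , isDIndependent C₃.graph C₃.I C₃.independent C₃.high-degree ,
   trans (cong (7 *_) C₃.size) (tower₃-size N)) ,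
  (3 + M₆.m , F₆.graph , ≤-trans (iterate-grows layer₆ triangle N) (m≤n+m _ 3) , F₆.drawing ,
   T₆.I , isDIndependent F₆.graph T₆.I T₆.independent T₆.high-degree ,
   trans (cong (2 *_) T₆.size) (tower₆-size N))
  where
  module M₃ = Marked (tower₃ N)
  module C₃ = NestSet cap₃-set M₃.set
  module M₆ = Marked (tower₆ N)
  module F₆ = Framed M₆.framed
  module T₆ = FramedSet M₆.set
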